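{- Let $n$ be a positive integer, and let $x_1,\ldots,x_n,y_1,\ldots,y_n$ be elements of a commutative ring with identity. Then $$\left|(x_i+y_j)^n\right|_{1\le i,j\le n}=(-1)^{n(n-1)/2}\prod_{1\le i<j\le n}(x_j-x_i)(y_j-y_i)\times\sum_{k=0}^n\Bigg(\prod_{r\in\{0,\ldots,n\}\setminus\{k\}}\binom nr\Bigg)\sigma_k(x_1,\ldots,x_n)\,\sigma_{n-k}(y_1,\ldots,y_n).$$
   Context: For a square matrix $[a_{ij}]_{1\le i,j\le n}$, $|a_{ij}|_{1\le i,j\le n}$ denotes its determinant. For $k=1,\ldots,n$, $\sigma_k(x_1,\ldots,x_n)=\sum_{1\le i_1<\cdots<i_k\le n}\prod_{j=1}^k x_{i_j}$ is the $k$th elementary symmetric polynomial, and $\sigma_0(x_1,\ldots,x_n)=1$. -}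

module Defs where

open import Level using (Level)
open import Algebra.Bundles using (CommutativeRing)
open import Data.Nat as ℕ using (ℕ; zero; suc)
open import Data.Nat.Combinatorics using (_C_)
open import Data.Fin using (Fin; zero; suc; toℕ; punchIn)
open import Data.Bool using (if_then_else_)
open import Data.Fin using (_≟_)
open import Relation.Nullary.Decidable using (does)

module RingDefs {c ℓ : Level} (R : CommutativeRing c ℓ) where
  open CommutativeRing R hiding (zero)

  Σ[<_]_ : (n : ℕ) → (Fin n → Carrier) → Carrier
  Σ[< zero ] f = 0#
  Σ[< suc n ] f = f zero + Σ[< n ] (λ i → f (suc i))

  Π[<_]_ : (n : ℕ) → (Fin n → Carrier) → Carrier
  Π[< zero ] f = 1#
  Π[< suc n ] f = f zero * Π[< n ] (λ i → f (suc i))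

  pow : Carrier → ℕ → Carrier
  pow x zero = 1#
  pow x (suc m) = x * pow x m

  fromℕ : ℕ → Carrier
  fromℕ zero = 0#
  fromℕ (suc m) = 1# + fromℕ m

  det : (n : ℕ) → (Fin n → Fin n → Carrier) → Carrier
  det zero M = 1#
  det (suc n) M =
    Σ[< suc n ] (λ j → pow (- 1#) (toℕ j) * M zero j
                        * det n (λ i k → M (suc i) (punchIn j k)))

  σ : (k n : ℕ) → (Fin n → Carrier) → Carrier
  σ zero n x = 1#
  σ (suc k) zero x = 0#
  σ (suc k) (suc n) x = x zero * σ k n (λ i → x (suc i)) + σ (suc k) n (λ i → x (suc i))

  Π-lt : (n : ℕ) → (Fin n → Fin n → Carrier) → Carrier
  Π-lt n f = Π[< n ] (λ j → Π[< n ] (λ i → if toℕ i ℕ.<ᵇ toℕ j then f i j else 1#))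

  binomProdExcept : (n : ℕ) → Fin (suc n) → Carrier
  binomProdExcept n k =
    Π[< suc n ] (λ r → if does (r ≟ k) then 1# else fromℕ (n C toℕ r))

module Submission where

-- By the binomial theorem (x_i + y_j)^n = Σ_r x_i^{n-r} · C(n,r) y_j^r, so the
-- matrix is the product A·K of an n×(n+1) matrix A = [x_i^{n-r}] and an (n+1)×n
-- matrix K = [C(n,r) y_j^r].  The Cauchy–Binet formula expands det(A·K) as the sum,
-- over the column k of A left out, of det(A without column k)·det(K without row k).
-- Both factors are "skipped" Vandermonde determinants: a Vandermonde determinant
-- with the exponent k omitted equals σ_{n-k} times the Vandermonde product.
-- Reversing the row order of the x-side turns exponents n-r into r, which costs the
-- sign (-1)^{n(n-1)/2} and replaces σ_{n-k} by σ_k.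

open import Defs
open import Level using (Level)
open import Algebra.Bundles using (CommutativeRing)
import Data.Nat
open import Data.Nat as ℕ using (ℕ; _≤_; _∸_; _/_; zero; suc; z≤n; s≤s)
import Data.Nat.Properties as ℕP
open import Data.Nat.DivMod using (m*n/n≡m)
open import Data.Nat.Combinatorics using (_C_)
open import Data.Nat.Tactic.RingSolver using (solve-∀)
open import Data.Fin as F using (Fin; toℕ; zero; suc; punchIn; inject₁; opposite)
import Data.Fin.Properties as FP
open import Data.Integer as ℤ using (ℤ; +_; -[1+_])
import Data.Integer.Properties as ℤP
open import Data.Maybe using (Maybe; nothing; just)
open import Data.Product using (_×_; _,_; proj₁; proj₂; Σ)
open import Data.Sum using (_⊎_; inj₁; inj₂)
open import Data.Bool using (Bool; if_then_else_; true; false; T)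
open import Data.Bool.Properties using (T-≡; ¬-not)
open import Function.Bundles using (Equivalence)
open import Relation.Binary.Definitions using (tri<; tri≈; tri>)
open import Data.Unit using (tt)
open import Data.Empty using (⊥-elim)
open import Function using (_∘_)
open import Relation.Binary.PropositionalEquality as P using (_≡_; _≢_)
open import Relation.Nullary using (yes; no; does)
open import Algebra.Solver.Ring.AlmostCommutativeRing using (fromCommutativeRing; _-Raw-AlmostCommutative⟶_)
import Algebra.Properties.CommutativeSemiring.Binomial
import Algebra.Properties.Semiring.Exp
import Algebra.Properties.Semiring.Mult
import Algebra.Properties.Semiring.Mult.TCOptimised
import Algebra.Properties.Semiring.Sum
import Algebra.Properties.Ring
import Algebra.Solver.Ring
import Relation.Binary.Reasoning.Setoid

toℕ-punchIn-< : ∀ {n} (i : Fin (suc n)) (j : Fin n) → toℕ j ℕ.< toℕ i → toℕ (punchIn i j) ≡ toℕ j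
toℕ-punchIn-< (suc i) zero lt = P.refl
toℕ-punchIn-< (suc i) (suc j) (s≤s lt) = P.cong suc (toℕ-punchIn-< i j lt)

toℕ-punchIn-≥ : ∀ {n} (i : Fin (suc n)) (j : Fin n) → toℕ i ≤ toℕ j → toℕ (punchIn i j) ≡ suc (toℕ j)
toℕ-punchIn-≥ zero j le = P.refl
toℕ-punchIn-≥ (suc i) (suc j) (s≤s le) = P.cong suc (toℕ-punchIn-≥ i j le)

-- The three identities below describe the two ways of deleting two columns i ≤ k
-- (first i then k, or first k+1 then i); they drive the pairing of terms in the
-- expansion of a determinant along its first two rows.
punchIn-inject₁-≤ : ∀ {n} (i k : Fin (suc n)) → toℕ i ≤ toℕ k → punchIn (inject₁ i) k ≡ suc k
punchIn-inject₁-≤ zero k le = P.refl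
punchIn-inject₁-≤ {suc n} (suc i) (suc k) (s≤s le) = P.cong suc (punchIn-inject₁-≤ i k le)

punchIn-suc-≤ : ∀ {n} (i k : Fin (suc n)) → toℕ i ≤ toℕ k → punchIn (suc k) i ≡ inject₁ i
punchIn-suc-≤ zero k le = P.refl
punchIn-suc-≤ {suc n} (suc i) (suc k) (s≤s le) = P.cong suc (punchIn-suc-≤ i k le)

punchIn-exchange : ∀ {n} (i k : Fin (suc n)) (b : Fin n) → toℕ i ≤ toℕ k →
  punchIn (inject₁ i) (punchIn k b) ≡ punchIn (suc k) (punchIn i b)
punchIn-exchange zero k b le = P.refl
punchIn-exchange {suc n} (suc i) (suc k) zero (s≤s le) = P.refl
punchIn-exchange {suc n} (suc i) (suc k) (suc b) (s≤s le) = P.cong suc (punchIn-exchange i k b le)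

punchIn-fromℕ : ∀ {n} (a : Fin n) → punchIn (F.fromℕ n) a ≡ inject₁ a
punchIn-fromℕ zero = P.refl
punchIn-fromℕ (suc a) = P.cong suc (punchIn-fromℕ a)

last-or-inject₁ : ∀ {n} (k : Fin (suc n)) → (k ≡ F.fromℕ n) ⊎ Σ (Fin n) (λ k' → k ≡ inject₁ k')
last-or-inject₁ {zero} zero = inj₁ P.refl
last-or-inject₁ {suc n} zero = inj₂ (zero , P.refl)
last-or-inject₁ {suc n} (suc k) with last-or-inject₁ k
... | inj₁ e = inj₁ (P.cong suc e)
... | inj₂ (k' , e) = inj₂ (suc k' , P.cong suc e)

module _ {n q a : ℕ} (split : q ℕ.+ suc a ≡ n) where
  ∸-left : n ∸ q ≡ suc a
  ∸-left = P.subst (λ n → n ∸ q ≡ suc a) split (ℕP.m+n∸m≡n q (suc a))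

  ∸-left-suc : n ∸ suc q ≡ a
  ∸-left-suc = P.subst (λ n → n ∸ suc q ≡ a) (P.trans (P.sym (ℕP.+-suc q a)) split) (ℕP.m+n∸m≡n q a)

  ∸-above : ∀ {b} → suc q ≤ b → n ∸ b ≤ a
  ∸-above {b} le = ℕP.m≤n+o⇒m∸n≤o n b
    (P.subst (_≤ b ℕ.+ a) (P.trans (P.sym (ℕP.+-suc q a)) split) (ℕP.+-monoˡ-≤ a le))

  ∸-below : ∀ {b} → b ≤ q → suc a ≤ n ∸ b
  ∸-below {b} le = ℕP.m+n≤o⇒m≤o∸n (suc a)
    (P.subst (suc a ℕ.+ b ≤_) (P.trans (ℕP.+-comm (suc a) q) split) (ℕP.+-monoʳ-≤ (suc a) le))

opposite-split : ∀ {n} (p : Fin n) → toℕ (opposite p) ℕ.+ suc (toℕ p) ≡ n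
opposite-split p = P.trans (P.cong (ℕ._+ suc (toℕ p)) (FP.opposite-prop p)) (ℕP.m∸n+n≡m (FP.toℕ<n p))

-- Reversing the order of the rows turns the exponents {0..n} ∖ {k}, listed through
-- punchIn k, into n minus the exponents {0..n} ∖ {n-k}.
punchIn-opposite : ∀ n (k : Fin (suc n)) (p : Fin n) →
  n ∸ toℕ (punchIn k (opposite p)) ≡ toℕ (punchIn (opposite k) p)
punchIn-opposite n k p with toℕ (opposite p) ℕP.<? toℕ k
... | yes lt = P.trans (P.cong (n ∸_) (toℕ-punchIn-< k (opposite p) lt))
  (P.trans (∸-left (opposite-split p)) (P.sym (toℕ-punchIn-≥ (opposite k) p
    (P.subst (_≤ toℕ p) (P.sym (FP.opposite-prop k)) (∸-above (opposite-split p) lt)))))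
... | no ≮ = P.trans (P.cong (n ∸_) (toℕ-punchIn-≥ k (opposite p) (ℕP.≮⇒≥ ≮)))
  (P.trans (∸-left-suc (opposite-split p)) (P.sym (toℕ-punchIn-< (opposite k) p
    (P.subst (toℕ p ℕ.<_) (P.sym (FP.opposite-prop k)) (∸-below (opposite-split p) (ℕP.≮⇒≥ ≮))))))

cons : ∀ {m k} → Fin m → (Fin k → Fin m) → Fin (suc k) → Fin m
cons a s zero = a
cons a s (suc i) = s i

tri : ℕ → ℕ
tri zero = zero
tri (suc n) = n ℕ.+ tri n

tri-eq : ∀ n → tri n ≡ (n ℕ.* (n ∸ 1)) / 2
tri-eq n = P.trans (P.sym (m*n/n≡m (tri n) 2)) (P.cong (_/ 2) (P.sym (twice n)))
  where
  step : ∀ m → suc (suc m) ℕ.* suc m ≡ suc m ℕ.* 2 ℕ.+ suc m ℕ.* m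
  step = solve-∀
  twice : ∀ n → n ℕ.* (n ∸ 1) ≡ tri n ℕ.* 2
  twice zero = P.refl
  twice (suc zero) = P.refl
  twice (suc (suc m)) = P.trans (step m) (P.trans (P.cong (suc m ℕ.* 2 ℕ.+_) (twice (suc m)))
    (P.sym (ℕP.*-distribʳ-+ 2 (suc m) (tri (suc m)))))

module _ {c ℓ : Level} (R : CommutativeRing c ℓ) where
  open CommutativeRing R hiding (zero)
  open RingDefs R
  open Algebra.Properties.Ring ring using (-‿involutive; -‿distribˡ-*; -‿distribʳ-*; -‿+-comm; -0#≈0#)
  open Algebra.Properties.Semiring.Mult.TCOptimised semiring using (1+×; ×-homo-+; ×1-homo-*)
    renaming (_×_ to _·_)
  open Relation.Binary.Reasoning.Setoid setoid

  -- The canonical map ℤ → R is a ring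
  -- homomorphism, which is what Algebra.Solver.Ring needs to normalise polynomial
  -- identities such as (-1)·(-1) = 1 or a·b - b·a = 0 in R.

  ι : ℤ → Carrier
  ι (+ n) = n · 1#
  ι -[1+ n ] = - (suc n · 1#)

  private
    shift-difference : ∀ a b → a - b ≈ (1# + a) - (1# + b)
    shift-difference a b = begin
      a - b                     ≈⟨ +-identityˡ _ ⟨
      0# + (a - b)              ≈⟨ +-congʳ (-‿inverseʳ 1#) ⟨
      (1# - 1#) + (a - b)       ≈⟨ +-assoc _ _ _ ⟩
      1# + (- 1# + (a - b))     ≈⟨ +-congˡ (+-assoc _ _ _) ⟨
      1# + ((- 1# + a) - b)     ≈⟨ +-congˡ (+-congʳ (+-comm _ _)) ⟩
      1# + ((a - 1#) - b)       ≈⟨ +-congˡ (+-assoc _ _ _) ⟩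
      1# + (a + (- 1# - b))     ≈⟨ +-assoc _ _ _ ⟨
      (1# + a) + (- 1# - b)     ≈⟨ +-congˡ (-‿+-comm 1# b) ⟩
      (1# + a) - (1# + b)       ∎

    x-0≈x : ∀ a → a - 0# ≈ a
    x-0≈x a = trans (+-congˡ -0#≈0#) (+-identityʳ a)

  ι-⊖ : ∀ m n → ι (m ℤ.⊖ n) ≈ m · 1# - n · 1#
  ι-⊖ zero zero = sym (x-0≈x 0#)
  ι-⊖ (suc m) zero = sym (x-0≈x _)
  ι-⊖ zero (suc n) = sym (+-identityˡ _)
  ι-⊖ (suc m) (suc n) = begin
    ι (suc m ℤ.⊖ suc n)           ≡⟨ P.cong ι (ℤP.[1+m]⊖[1+n]≡m⊖n m n) ⟩
    ι (m ℤ.⊖ n)                   ≈⟨ ι-⊖ m n ⟩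
    m · 1# - n · 1#               ≈⟨ shift-difference _ _ ⟩
    (1# + m · 1#) - (1# + n · 1#) ≈⟨ +-cong (1+× m 1#) (-‿cong (1+× n 1#)) ⟨
    suc m · 1# - suc n · 1#       ∎

  ι-+ : ∀ i j → ι (i ℤ.+ j) ≈ ι i + ι j
  ι-+ (+ m) (+ n) = ×-homo-+ 1# m n
  ι-+ (+ m) -[1+ n ] = ι-⊖ m (suc n)
  ι-+ -[1+ m ] (+ n) = trans (ι-⊖ n (suc m)) (+-comm _ _)
  ι-+ -[1+ m ] -[1+ n ] = begin
    - (suc (suc (m ℕ.+ n)) · 1#)    ≡⟨ P.cong (λ t → - (t · 1#)) shifted ⟩
    - ((suc m ℕ.+ suc n) · 1#)      ≈⟨ -‿cong (×-homo-+ 1# (suc m) (suc n)) ⟩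
    - (suc m · 1# + suc n · 1#)     ≈⟨ -‿+-comm _ _ ⟨
    - (suc m · 1#) - (suc n · 1#)   ∎
    where
    shifted : suc (suc (m ℕ.+ n)) ≡ suc m ℕ.+ suc n
    shifted = P.cong suc (P.sym (ℕP.+-suc m n))

  ι-* : ∀ i j → ι (i ℤ.* j) ≈ ι i * ι j
  ι-* (+ zero) j = sym (zeroˡ _)
  ι-* (+ suc m) (+ zero) rewrite ℕP.*-zeroʳ m = sym (zeroʳ _)
  ι-* (+ suc m) (+ suc n) = ×1-homo-* (suc m) (suc n)
  ι-* (+ suc m) -[1+ n ] = trans (-‿cong (×1-homo-* (suc m) (suc n))) (-‿distribʳ-* _ _)
  ι-* -[1+ m ] (+ zero) rewrite ℕP.*-zeroʳ m = sym (zeroʳ _)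
  ι-* -[1+ m ] (+ suc n) = trans (-‿cong (×1-homo-* (suc m) (suc n))) (-‿distribˡ-* _ _)
  ι-* -[1+ m ] -[1+ n ] = trans (×1-homo-* (suc m) (suc n))
    (sym (trans (sym (-‿distribˡ-* _ _)) (trans (-‿cong (sym (-‿distribʳ-* _ _))) (-‿involutive _))))

  ι-neg : ∀ i → ι (ℤ.- i) ≈ - ι i
  ι-neg (+ zero) = sym -0#≈0#
  ι-neg (+ suc n) = refl
  ι-neg -[1+ n ] = sym (-‿involutive _)

  ι-homomorphism : ℤ.+-*-rawRing -Raw-AlmostCommutative⟶ fromCommutativeRing R
  ι-homomorphism = record
    { ⟦_⟧ = ι ; +-homo = ι-+ ; *-homo = ι-* ; -‿homo = ι-neg ; 0-homo = refl ; 1-homo = refl }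

  ι-equal? : ∀ i j → Maybe (ι i ≈ ι j)
  ι-equal? i j with i ℤ.≟ j
  ... | yes P.refl = just refl
  ... | no _ = nothing

  open Algebra.Solver.Ring ℤ.+-*-rawRing (fromCommutativeRing R) ι-homomorphism ι-equal?
    using (solve; _:+_; _:*_; :-_; _:-_; _:=_; con)

  Σ-cong : ∀ n {f g : Fin n → Carrier} → (∀ i → f i ≈ g i) → Σ[< n ] f ≈ Σ[< n ] g
  Σ-cong zero e = refl
  Σ-cong (suc n) e = +-cong (e zero) (Σ-cong n (λ i → e (suc i)))

  Σ-distrib-+ : ∀ n (f g : Fin n → Carrier) → Σ[< n ] (λ i → f i + g i) ≈ Σ[< n ] f + Σ[< n ] g
  Σ-distrib-+ zero f g = sym (+-identityˡ _)
  Σ-distrib-+ (suc n) f g = trans (+-congˡ (Σ-distrib-+ n _ _))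
    (solve 4 (λ a b c d → (a :+ b) :+ (c :+ d) := (a :+ c) :+ (b :+ d)) refl _ _ _ _)

  Σ-zero : ∀ n {f : Fin n → Carrier} → (∀ i → f i ≈ 0#) → Σ[< n ] f ≈ 0#
  Σ-zero zero e = refl
  Σ-zero (suc n) e = trans (+-cong (e zero) (Σ-zero n (λ i → e (suc i)))) (+-identityˡ _)

  Σ-*ˡ : ∀ n a (f : Fin n → Carrier) → a * Σ[< n ] f ≈ Σ[< n ] (λ i → a * f i)
  Σ-*ˡ zero a f = zeroʳ _
  Σ-*ˡ (suc n) a f = trans (distribˡ _ _ _) (+-congˡ (Σ-*ˡ n a _))

  Σ-*ʳ : ∀ n a (f : Fin n → Carrier) → Σ[< n ] f * a ≈ Σ[< n ] (λ i → f i * a)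
  Σ-*ʳ n a f = trans (*-comm _ _) (trans (Σ-*ˡ n a f) (Σ-cong n (λ i → *-comm _ _)))

  Σ-neg : ∀ n (f : Fin n → Carrier) → - Σ[< n ] f ≈ Σ[< n ] (λ i → - f i)
  Σ-neg zero f = -0#≈0#
  Σ-neg (suc n) f = trans (sym (-‿+-comm _ _)) (+-congˡ (Σ-neg n (λ i → f (suc i))))

  Σ-comm : ∀ n m (f : Fin n → Fin m → Carrier) →
    Σ[< n ] (λ i → Σ[< m ] (λ j → f i j)) ≈ Σ[< m ] (λ j → Σ[< n ] (λ i → f i j))
  Σ-comm zero m f = sym (Σ-zero m (λ _ → refl))
  Σ-comm (suc n) m f = trans (+-congˡ (Σ-comm n m _)) (sym (Σ-distrib-+ m _ _))

  Π-cong : ∀ n {f g : Fin n → Carrier} → (∀ i → f i ≈ g i) → Π[< n ] f ≈ Π[< n ] g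
  Π-cong zero e = refl
  Π-cong (suc n) e = *-cong (e zero) (Π-cong n (λ i → e (suc i)))

  Π-distrib-* : ∀ n (f g : Fin n → Carrier) → Π[< n ] (λ i → f i * g i) ≈ Π[< n ] f * Π[< n ] g
  Π-distrib-* zero f g = sym (*-identityˡ _)
  Π-distrib-* (suc n) f g = trans (*-congˡ (Π-distrib-* n _ _))
    (solve 4 (λ a b c d → (a :* b) :* (c :* d) := (a :* c) :* (b :* d)) refl _ _ _ _)

  Π-one : ∀ n {f : Fin n → Carrier} → (∀ i → f i ≈ 1#) → Π[< n ] f ≈ 1#
  Π-one zero e = refl
  Π-one (suc n) e = trans (*-cong (e zero) (Π-one n (λ i → e (suc i)))) (*-identityˡ _)

  sgn : ℕ → Carrier
  sgn k = pow (- 1#) k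

  sgn-+ : ∀ a b → sgn (a ℕ.+ b) ≈ sgn a * sgn b
  sgn-+ zero b = sym (*-identityˡ _)
  sgn-+ (suc a) b = trans (*-congˡ (sgn-+ a b)) (sym (*-assoc _ _ _))

  sgn-square : ∀ a → sgn a * sgn a ≈ 1#
  sgn-square zero = *-identityˡ _
  sgn-square (suc a) = begin
    (- 1# * sgn a) * (- 1# * sgn a)     ≈⟨ solve 1 (λ s → (:- con (+ 1) :* s) :* (:- con (+ 1) :* s) := s :* s) refl _ ⟩
    sgn a * sgn a                       ≈⟨ sgn-square a ⟩
    1#                                  ∎

  sgn-inject₁ : ∀ {n} (i : Fin n) → sgn (toℕ (inject₁ i)) ≈ sgn (toℕ i)
  sgn-inject₁ i = reflexive (P.cong sgn (FP.toℕ-inject₁ i))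

  Mat : ℕ → Set c
  Mat n = Fin n → Fin n → Carrier

  minor : ∀ {n} → Mat (suc n) → Fin (suc n) → Mat n
  minor M j i k = M (suc i) (punchIn j k)

  det-cong : ∀ n {M N : Mat n} → (∀ i j → M i j ≈ N i j) → det n M ≈ det n N
  det-cong zero e = refl
  det-cong (suc n) e = Σ-cong (suc n) (λ j →
    *-cong (*-congˡ {x = sgn (toℕ j)} (e zero j)) (det-cong n (λ i k → e (suc i) (punchIn j k))))

  -- Sums over pairs (j, k) of distinct columns, the second listed through punchIn j.
  doubleSum : ∀ n → (Fin (suc (suc n)) → Fin (suc n) → Carrier) → Carrier
  doubleSum n f = Σ[< suc (suc n) ] (λ j → Σ[< suc n ] (f j))

  doubleSum-split : ∀ n (f : Fin (suc (suc n)) → Fin (suc n) → Carrier) →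
    doubleSum n f ≈ Σ[< suc n ] (λ k → f zero k) + Σ[< suc n ] (λ k → f (suc k) zero)
                    + Σ[< suc n ] (λ j → Σ[< n ] (λ k → f (suc j) (suc k)))
  doubleSum-split n f = begin
    Σ[< suc n ] (f zero) + Σ[< suc n ] (λ j → f (suc j) zero + Σ[< n ] (λ k → f (suc j) (suc k)))
      ≈⟨ +-congˡ (Σ-distrib-+ (suc n) (λ j → f (suc j) zero) (λ j → Σ[< n ] (λ k → f (suc j) (suc k)))) ⟩
    Σ[< suc n ] (f zero) + (Σ[< suc n ] (λ j → f (suc j) zero) + Σ[< suc n ] (λ j → Σ[< n ] (λ k → f (suc j) (suc k))))
      ≈⟨ +-assoc _ _ _ ⟨
    Σ[< suc n ] (f zero) + Σ[< suc n ] (λ k → f (suc k) zero) + Σ[< suc n ] (λ j → Σ[< n ] (λ k → f (suc j) (suc k))) ∎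

  -- If the term at (i, k) cancels the term at (k+1, i) whenever i ≤ k, the whole
  -- double sum vanishes: these pairs exhaust all pairs of distinct columns.
  doubleSum-cancel : ∀ n (f : Fin (suc (suc n)) → Fin (suc n) → Carrier) →
    (∀ i k → toℕ i ≤ toℕ k → f (inject₁ i) k + f (suc k) i ≈ 0#) → doubleSum n f ≈ 0#
  doubleSum-cancel n f pair = trans (doubleSum-split n f)
    (trans (+-cong (trans (sym (Σ-distrib-+ (suc n) (f zero) (λ k → f (suc k) zero))) (Σ-zero (suc n) (λ k → pair zero k z≤n)))
                   (inner-zero n f pair))
           (+-identityˡ 0#))
    where
    inner-zero : ∀ n (f : Fin (suc (suc n)) → Fin (suc n) → Carrier) →
      (∀ i k → toℕ i ≤ toℕ k → f (inject₁ i) k + f (suc k) i ≈ 0#) →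
      Σ[< suc n ] (λ j → Σ[< n ] (λ k → f (suc j) (suc k))) ≈ 0#
    inner-zero zero f pair = Σ-zero 1 (λ _ → refl)
    inner-zero (suc n) f pair =
      doubleSum-cancel n (λ j k → f (suc j) (suc k)) (λ i k le → pair (suc i) (suc k) (s≤s le))

  doubleSum-cancel₂ : ∀ n (f g : Fin (suc (suc n)) → Fin (suc n) → Carrier) →
    (∀ i k → toℕ i ≤ toℕ k → f (inject₁ i) k + g (suc k) i ≈ 0#) →
    (∀ i k → toℕ i ≤ toℕ k → f (suc k) i + g (inject₁ i) k ≈ 0#) →
    doubleSum n f + doubleSum n g ≈ 0#
  doubleSum-cancel₂ n f g pair₁ pair₂ = begin
    doubleSum n f + doubleSum n g ≈⟨ +-cong (doubleSum-split n f) (doubleSum-split n g) ⟩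
    (A + B + Rf) + (A' + B' + Rg)
      ≈⟨ solve 6 (λ A B A' B' Rf Rg → (A :+ B :+ Rf) :+ (A' :+ B' :+ Rg) := (A :+ B') :+ (B :+ A') :+ (Rf :+ Rg)) refl A B A' B' Rf Rg ⟩
    (A + B') + (B + A') + (Rf + Rg)
      ≈⟨ +-cong (+-cong (trans (sym (Σ-distrib-+ (suc n) (f zero) (λ k → g (suc k) zero))) (Σ-zero (suc n) (λ k → pair₁ zero k z≤n)))
                        (trans (sym (Σ-distrib-+ (suc n) (λ k → f (suc k) zero) (g zero))) (Σ-zero (suc n) (λ k → pair₂ zero k z≤n))))
                (inner-zero n f g pair₁ pair₂) ⟩
    0# + 0# + 0# ≈⟨ solve 0 (con (+ 0) :+ con (+ 0) :+ con (+ 0) := con (+ 0)) refl ⟩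
    0# ∎
    where
    A = Σ[< suc n ] (f zero)
    B = Σ[< suc n ] (λ k → f (suc k) zero)
    A' = Σ[< suc n ] (g zero)
    B' = Σ[< suc n ] (λ k → g (suc k) zero)
    Rf = Σ[< suc n ] (λ j → Σ[< n ] (λ k → f (suc j) (suc k)))
    Rg = Σ[< suc n ] (λ j → Σ[< n ] (λ k → g (suc j) (suc k)))
    inner-zero : ∀ n (f g : Fin (suc (suc n)) → Fin (suc n) → Carrier) →
      (∀ i k → toℕ i ≤ toℕ k → f (inject₁ i) k + g (suc k) i ≈ 0#) →
      (∀ i k → toℕ i ≤ toℕ k → f (suc k) i + g (inject₁ i) k ≈ 0#) →
      Σ[< suc n ] (λ j → Σ[< n ] (λ k → f (suc j) (suc k))) + Σ[< suc n ] (λ j → Σ[< n ] (λ k → g (suc j) (suc k))) ≈ 0#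
    inner-zero zero f g _ _ = solve 0 ((con (+ 0) :+ con (+ 0)) :+ (con (+ 0) :+ con (+ 0)) := con (+ 0)) refl
    inner-zero (suc n) f g pair₁ pair₂ = doubleSum-cancel₂ n (λ j k → f (suc j) (suc k)) (λ j k → g (suc j) (suc k))
      (λ i k le → pair₁ (suc i) (suc k) (s≤s le)) (λ i k le → pair₂ (suc i) (suc k) (s≤s le))

  twoRowTerm : ∀ n → Mat (suc (suc n)) → Fin (suc (suc n)) → Fin (suc n) → Carrier
  twoRowTerm n M j k = (sgn (toℕ j) * M zero j) * (sgn (toℕ k) * M (suc zero) (punchIn j k)
                        * det n (λ a b → M (suc (suc a)) (punchIn j (punchIn k b))))

  det-expand-two-rows : ∀ n (M : Mat (suc (suc n))) → det (suc (suc n)) M ≈ doubleSum n (twoRowTerm n M)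
  det-expand-two-rows n M = Σ-cong (suc (suc n)) (λ j → Σ-*ˡ (suc n) (sgn (toℕ j) * M zero j) (λ k →
    sgn (toℕ k) * M (suc zero) (punchIn j k) * det n (λ a b → M (suc (suc a)) (punchIn j (punchIn k b)))))

  -- The two terms of a pair differ by the sign (-1)^{i+k} versus (-1)^{k+1+i}.
  cross-terms-cancel : ∀ s t a b D D' → D ≈ D' → s * a * (t * b * D) + (- 1# * t) * b * (s * a * D') ≈ 0#
  cross-terms-cancel s t a b D D' D≈D' = trans (+-congˡ (*-congˡ (*-congˡ (sym D≈D'))))
    (solve 5 (λ s t a b D → s :* a :* (t :* b :* D) :+ (:- con (+ 1) :* t) :* b :* (s :* a :* D) := con (+ 0)) refl s t a b D)

  -- Equal first two rows: the terms of the two-row expansion cancel in pairs.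
  det-equal-first-rows : ∀ n (M : Mat (suc (suc n))) → (∀ j → M zero j ≈ M (suc zero) j) → det (suc (suc n)) M ≈ 0#
  det-equal-first-rows n M rows≈ = trans (det-expand-two-rows n M) (doubleSum-cancel n (twoRowTerm n M) pair)
    where
    pair : ∀ i k → toℕ i ≤ toℕ k → twoRowTerm n M (inject₁ i) k + twoRowTerm n M (suc k) i ≈ 0#
    pair i k le = trans (+-cong
       (*-cong (*-congʳ (sgn-inject₁ i))
          (*-congʳ {x = det n _} (*-congˡ {x = sgn (toℕ k)} (reflexive (P.cong (M (suc zero)) (punchIn-inject₁-≤ i k le))))))
       (*-cong (*-congˡ (rows≈ (suc k)))
          (*-congʳ {x = det n _} (*-congˡ {x = sgn (toℕ i)}
            (trans (reflexive (P.cong (M (suc zero)) (punchIn-suc-≤ i k le))) (sym (rows≈ (inject₁ i))))))))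
       (cross-terms-cancel (sgn (toℕ i)) (sgn (toℕ k)) (M zero (inject₁ i)) (M (suc zero) (suc k)) _ _
         (det-cong n (λ a b → reflexive (P.cong (M (suc (suc a))) (punchIn-exchange i k b le)))))

  det-equal-adjacent-rows : ∀ n (M : Mat (suc (suc n))) (p : Fin (suc n)) →
    (∀ j → M (inject₁ p) j ≈ M (suc p) j) → det (suc (suc n)) M ≈ 0#
  det-equal-adjacent-rows n M zero rows≈ = det-equal-first-rows n M rows≈
  det-equal-adjacent-rows (suc n) M (suc p) rows≈ = Σ-zero (suc (suc (suc n))) (λ j →
    trans (*-congˡ {x = sgn (toℕ j) * M zero j} (det-equal-adjacent-rows n (minor M j) p (λ b → rows≈ (punchIn j b)))) (zeroʳ _))

  AdjacentSwap : ∀ {n} → Fin (suc n) → Mat (suc (suc n)) → Mat (suc (suc n)) → Set ℓ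
  AdjacentSwap p M N = (∀ j → N (inject₁ p) j ≈ M (suc p) j) × (∀ j → N (suc p) j ≈ M (inject₁ p) j)
    × (∀ i → i ≢ inject₁ p → i ≢ suc p → ∀ j → N i j ≈ M i j)

  sum≈0⇒≈neg : ∀ {x y} → x + y ≈ 0# → x ≈ - y
  sum≈0⇒≈neg {x} {y} x+y≈0 = begin
    x             ≈⟨ solve 2 (λ x y → x := (x :+ y) :- y) refl x y ⟩
    (x + y) - y   ≈⟨ +-congʳ x+y≈0 ⟩
    0# - y        ≈⟨ +-identityˡ _ ⟩
    - y           ∎

  det-swap-adjacent : ∀ n (p : Fin (suc n)) (M N : Mat (suc (suc n))) → AdjacentSwap p M N →
    det (suc (suc n)) N ≈ - det (suc (suc n)) M
  det-swap-adjacent n zero M N (row₀ , row₁ , rest) = sum≈0⇒≈neg (trans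
    (+-cong (det-expand-two-rows n N) (det-expand-two-rows n M))
    (doubleSum-cancel₂ n (twoRowTerm n N) (twoRowTerm n M) pair₁ pair₂))
    where
    lower : ∀ a b → N (suc (suc a)) b ≈ M (suc (suc a)) b
    lower a b = rest (suc (suc a)) (λ ()) (λ ()) b
    pair₁ : ∀ i k → toℕ i ≤ toℕ k → twoRowTerm n N (inject₁ i) k + twoRowTerm n M (suc k) i ≈ 0#
    pair₁ i k le = trans (+-cong
       (*-cong (*-cong (sgn-inject₁ i) (row₀ (inject₁ i)))
          (*-congʳ {x = det n _} (*-congˡ {x = sgn (toℕ k)}
            (trans (reflexive (P.cong (N (suc zero)) (punchIn-inject₁-≤ i k le))) (row₁ (suc k))))))
       (*-congˡ {x = sgn (toℕ (suc k)) * M zero (suc k)} (*-congʳ {x = det n _} (*-congˡ {x = sgn (toℕ i)}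
          (reflexive (P.cong (M (suc zero)) (punchIn-suc-≤ i k le)))))))
       (cross-terms-cancel (sgn (toℕ i)) (sgn (toℕ k)) (M (suc zero) (inject₁ i)) (M zero (suc k)) _ _
         (det-cong n (λ a b → trans (lower a _) (reflexive (P.cong (M (suc (suc a))) (punchIn-exchange i k b le))))))
    pair₂ : ∀ i k → toℕ i ≤ toℕ k → twoRowTerm n N (suc k) i + twoRowTerm n M (inject₁ i) k ≈ 0#
    pair₂ i k le = trans (+-comm _ _) (trans (+-cong
       (*-cong (*-congʳ (sgn-inject₁ i))
          (*-congʳ {x = det n _} (*-congˡ {x = sgn (toℕ k)} (reflexive (P.cong (M (suc zero)) (punchIn-inject₁-≤ i k le))))))
       (*-cong (*-congˡ {x = sgn (toℕ (suc k))} (row₀ (suc k)))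
          (*-congʳ {x = det n _} (*-congˡ {x = sgn (toℕ i)}
            (trans (reflexive (P.cong (N (suc zero)) (punchIn-suc-≤ i k le))) (row₁ (inject₁ i)))))))
       (cross-terms-cancel (sgn (toℕ i)) (sgn (toℕ k)) (M zero (inject₁ i)) (M (suc zero) (suc k)) _ _
         (det-cong n (λ a b → trans (reflexive (P.cong (M (suc (suc a))) (punchIn-exchange i k b le))) (sym (lower a _))))))
  det-swap-adjacent (suc n) (suc p) M N (row₀ , row₁ , rest) = begin
    det (suc (suc (suc n))) N
      ≈⟨ Σ-cong (suc (suc (suc n))) (λ j → *-cong (*-congˡ {x = sgn (toℕ j)} (rest zero (λ ()) (λ ()) j))
           (det-swap-adjacent n p (minor M j) (minor N j)
              ((λ b → row₀ (punchIn j b)) , (λ b → row₁ (punchIn j b)) ,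
               (λ i ne₁ ne₂ b → rest (suc i) (ne₁ ∘ FP.suc-injective) (ne₂ ∘ FP.suc-injective) (punchIn j b))))) ⟩
    Σ[< suc (suc (suc n)) ] (λ j → sgn (toℕ j) * M zero j * - det (suc (suc n)) (minor M j))
      ≈⟨ Σ-cong (suc (suc (suc n))) (λ j → sym (-‿distribʳ-* (sgn (toℕ j) * M zero j) (det (suc (suc n)) (minor M j)))) ⟩
    Σ[< suc (suc (suc n)) ] (λ j → - (sgn (toℕ j) * M zero j * det (suc (suc n)) (minor M j)))
      ≈⟨ Σ-neg (suc (suc (suc n))) (λ j → sgn (toℕ j) * M zero j * det (suc (suc n)) (minor M j)) ⟨
    - det (suc (suc (suc n))) M ∎

  det-expand-first-column : ∀ n (N : Mat (suc n)) → det (suc n) N ≈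
    Σ[< suc n ] (λ j → sgn (toℕ j) * N j zero * det n (λ a b → N (punchIn j a) (suc b)))
  det-expand-first-column zero N = refl
  det-expand-first-column (suc m) N = +-congˡ (begin
    Σ[< suc m ] (λ c → sgn (suc (toℕ c)) * N zero (suc c) * det (suc m) (minor N (suc c)))
      ≈⟨ Σ-cong (suc m) (λ c → trans (*-congˡ {x = sgn (suc (toℕ c)) * N zero (suc c)} (det-expand-first-column m (minor N (suc c))))
             (Σ-*ˡ (suc m) _ (λ a → sgn (toℕ a) * N (suc a) zero * D c a))) ⟩
    Σ[< suc m ] (λ c → Σ[< suc m ] (λ a → (sgn (suc (toℕ c)) * N zero (suc c)) * (sgn (toℕ a) * N (suc a) zero * D c a)))
      ≈⟨ Σ-comm (suc m) (suc m) (λ c a → (sgn (suc (toℕ c)) * N zero (suc c)) * (sgn (toℕ a) * N (suc a) zero * D c a)) ⟩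
    Σ[< suc m ] (λ a → Σ[< suc m ] (λ c → (sgn (suc (toℕ c)) * N zero (suc c)) * (sgn (toℕ a) * N (suc a) zero * D c a)))
      ≈⟨ Σ-cong (suc m) (λ a → Σ-cong (suc m) (λ c →
          solve 5 (λ s t x y d → (:- con (+ 1) :* s :* x) :* (t :* y :* d) := (:- con (+ 1) :* t :* y) :* (s :* x :* d)) refl
            (sgn (toℕ c)) (sgn (toℕ a)) (N zero (suc c)) (N (suc a) zero) (D c a))) ⟩
    Σ[< suc m ] (λ a → Σ[< suc m ] (λ c → (sgn (suc (toℕ a)) * N (suc a) zero) * (sgn (toℕ c) * N zero (suc c) * D c a)))
      ≈⟨ Σ-cong (suc m) (λ a → sym (Σ-*ˡ (suc m) (sgn (suc (toℕ a)) * N (suc a) zero) (λ c → sgn (toℕ c) * N zero (suc c) * D c a))) ⟩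
    Σ[< suc m ] (λ a → sgn (suc (toℕ a)) * N (suc a) zero * det (suc m) (λ a' b → N (punchIn (suc a) a') (suc b))) ∎)
    where
    D : Fin (suc m) → Fin (suc m) → Carrier
    D c a = det m (λ a' b' → N (suc (punchIn a a')) (suc (punchIn c b')))

  -- Transposition invariance: expansion along the first column is the expansion of
  -- the transpose along its first row.
  det-transpose : ∀ n (N : Mat n) → det n (λ i j → N j i) ≈ det n N
  det-transpose zero N = refl
  det-transpose (suc n) N = trans
    (Σ-cong (suc n) (λ j → *-congˡ {x = sgn (toℕ j) * N j zero} (det-transpose n (λ a b → N (punchIn j a) (suc b)))))
    (sym (det-expand-first-column n N))

  det-scale-rows : ∀ n (cc : Fin n → Carrier) (N : Mat n) → det n (λ i j → cc i * N i j) ≈ Π[< n ] cc * det n N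
  det-scale-rows zero cc N = sym (*-identityˡ _)
  det-scale-rows (suc n) cc N = begin
    Σ[< suc n ] (λ j → sgn (toℕ j) * (cc zero * N zero j) * det n (λ a b → cc (suc a) * N (suc a) (punchIn j b)))
      ≈⟨ Σ-cong (suc n) (λ j → trans (*-congˡ {x = sgn (toℕ j) * (cc zero * N zero j)} (det-scale-rows n (λ a → cc (suc a)) (minor N j)))
           (solve 5 (λ s c0 x p d → s :* (c0 :* x) :* (p :* d) := (c0 :* p) :* (s :* x :* d)) refl _ _ _ _ _)) ⟩
    Σ[< suc n ] (λ j → (cc zero * Π[< n ] (λ a → cc (suc a))) * (sgn (toℕ j) * N zero j * det n (minor N j)))
      ≈⟨ sym (Σ-*ˡ (suc n) (cc zero * Π[< n ] (λ a → cc (suc a))) (λ j → sgn (toℕ j) * N zero j * det n (minor N j))) ⟩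
    Π[< suc n ] cc * det (suc n) N ∎

  det-linear-row : ∀ n (p : Fin n) (α β : Carrier) (M M1 M2 : Mat n) →
    (∀ j → M p j ≈ α * M1 p j + β * M2 p j) →
    (∀ i → i ≢ p → ∀ j → (M i j ≈ M1 i j) × (M i j ≈ M2 i j)) →
    det n M ≈ α * det n M1 + β * det n M2
  det-linear-row (suc n) zero α β M M1 M2 row-p others = begin
    Σ[< suc n ] (λ j → sgn (toℕ j) * M zero j * det n (minor M j))
      ≈⟨ Σ-cong (suc n) (λ j → *-cong (*-congˡ {x = sgn (toℕ j)} (row-p j))
            (det-cong n (λ a b → proj₁ (others (suc a) (λ ()) (punchIn j b))))) ⟩
    Σ[< suc n ] (λ j → sgn (toℕ j) * (α * M1 zero j + β * M2 zero j) * D1 j)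
      ≈⟨ Σ-cong (suc n) split-row ⟩
    Σ[< suc n ] (λ j → α * (sgn (toℕ j) * M1 zero j * D1 j) + β * (sgn (toℕ j) * M2 zero j * D2 j))
      ≈⟨ Σ-distrib-+ (suc n) (λ j → α * (sgn (toℕ j) * M1 zero j * D1 j)) (λ j → β * (sgn (toℕ j) * M2 zero j * D2 j)) ⟩
    Σ[< suc n ] (λ j → α * (sgn (toℕ j) * M1 zero j * D1 j)) + Σ[< suc n ] (λ j → β * (sgn (toℕ j) * M2 zero j * D2 j))
      ≈⟨ +-cong (sym (Σ-*ˡ (suc n) α (λ j → sgn (toℕ j) * M1 zero j * D1 j))) (sym (Σ-*ˡ (suc n) β (λ j → sgn (toℕ j) * M2 zero j * D2 j))) ⟩
    α * det (suc n) M1 + β * det (suc n) M2 ∎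
    where
    D1 D2 : Fin (suc n) → Carrier
    D1 j = det n (minor M1 j)
    D2 j = det n (minor M2 j)
    D12 : ∀ j → D1 j ≈ D2 j
    D12 j = det-cong n (λ a b → trans (sym (proj₁ (others (suc a) (λ ()) (punchIn j b)))) (proj₂ (others (suc a) (λ ()) (punchIn j b))))
    split-row : ∀ j → sgn (toℕ j) * (α * M1 zero j + β * M2 zero j) * D1 j ≈
                α * (sgn (toℕ j) * M1 zero j * D1 j) + β * (sgn (toℕ j) * M2 zero j * D2 j)
    split-row j = trans (solve 6 (λ s a b x y d → s :* (a :* x :+ b :* y) :* d := a :* (s :* x :* d) :+ b :* (s :* y :* d)) refl _ _ _ _ _ _)
      (+-congˡ (*-congˡ (*-congˡ (D12 j))))
  det-linear-row (suc n) (suc p) α β M M1 M2 row-p others = begin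
    Σ[< suc n ] (λ j → sgn (toℕ j) * M zero j * det n (minor M j))
      ≈⟨ Σ-cong (suc n) (λ j → *-cong (*-congˡ {x = sgn (toℕ j)} (proj₁ (others zero (λ ()) j)))
           (det-linear-row n p α β _ _ _ (λ b → row-p (punchIn j b)) (λ i ne b → others (suc i) (λ q → ne (FP.suc-injective q)) (punchIn j b)))) ⟩
    Σ[< suc n ] (λ j → sgn (toℕ j) * M1 zero j * (α * E1 j + β * E2 j))
      ≈⟨ Σ-cong (suc n) (λ j → trans (solve 6 (λ s x a b d e → s :* x :* (a :* d :+ b :* e) := a :* (s :* x :* d) :+ b :* (s :* x :* e)) refl (sgn (toℕ j)) (M1 zero j) α β (E1 j) (E2 j))
            (+-congˡ (*-congˡ (*-congʳ (*-congˡ (trans (sym (proj₁ (others zero (λ ()) j))) (proj₂ (others zero (λ ()) j)))))))) ⟩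
    Σ[< suc n ] (λ j → α * (sgn (toℕ j) * M1 zero j * E1 j) + β * (sgn (toℕ j) * M2 zero j * E2 j))
      ≈⟨ Σ-distrib-+ (suc n) (λ j → α * (sgn (toℕ j) * M1 zero j * E1 j)) (λ j → β * (sgn (toℕ j) * M2 zero j * E2 j)) ⟩
    Σ[< suc n ] (λ j → α * (sgn (toℕ j) * M1 zero j * E1 j)) + Σ[< suc n ] (λ j → β * (sgn (toℕ j) * M2 zero j * E2 j))
      ≈⟨ +-cong (sym (Σ-*ˡ (suc n) α (λ j → sgn (toℕ j) * M1 zero j * E1 j))) (sym (Σ-*ˡ (suc n) β (λ j → sgn (toℕ j) * M2 zero j * E2 j))) ⟩
    α * det (suc n) M1 + β * det (suc n) M2 ∎
    where
    E1 E2 : Fin (suc n) → Carrier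
    E1 j = det n (minor M1 j)
    E2 j = det n (minor M2 j)

  det-zero-first-column : ∀ n (N : Mat (suc n)) → (∀ i → N i zero ≈ 0#) → det (suc n) N ≈ 0#
  det-zero-first-column zero N e = trans (+-identityʳ _) (trans (*-congʳ (*-congˡ (e zero))) (trans (*-congʳ (zeroʳ _)) (zeroˡ _)))
  det-zero-first-column (suc n) N e = Σ-zero (suc (suc n)) h
    where
    h : ∀ j → sgn (toℕ j) * N zero j * det (suc n) (minor N j) ≈ 0#
    h zero = trans (*-congʳ (*-congˡ (e zero))) (trans (*-congʳ (zeroʳ _)) (zeroˡ _))
    h (suc j) = trans (*-congˡ {x = sgn (toℕ (suc j)) * N zero (suc j)} (det-zero-first-column n (minor N (suc j)) (λ a → e (suc a)))) (zeroʳ _)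

  det-unit-first-row : ∀ n (N : Mat (suc n)) → N zero zero ≈ 1# → (∀ j → N zero (suc j) ≈ 0#) →
    det (suc n) N ≈ det n (λ a b → N (suc a) (suc b))
  det-unit-first-row n N e1 e0 = trans (+-cong (trans (*-congʳ (trans (*-congˡ e1) (*-identityʳ _))) (*-identityˡ _))
     (Σ-zero n (λ j → trans (*-congʳ (trans (*-congˡ (e0 j)) (zeroʳ _))) (zeroˡ _)))) (+-identityʳ _)

  -- raise j N moves row j of N to the top, keeping the other rows in order; this is a
  -- cycle of j adjacent transpositions.
  raise : ∀ {n} {A : Set c} → Fin (suc n) → (Fin (suc n) → A) → (Fin (suc n) → A)
  raise j N zero = N j
  raise j N (suc a) = N (punchIn j a)

  det-raise-row : ∀ n (j : Fin (suc n)) (N : Mat (suc n)) → det (suc n) (raise j N) ≈ sgn (toℕ j) * det (suc n) N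
  det-raise-row n zero N = trans (det-cong (suc n) h) (sym (*-identityˡ _))
    where
    h : ∀ i k → raise zero N i k ≈ N i k
    h zero k = refl
    h (suc i) k = refl
  det-raise-row (suc n) (suc j) N = begin
    det (suc (suc n)) (raise (suc j) N) ≈⟨ det-swap-adjacent n zero Q (raise (suc j) N) (q0 , q1 , qr) ⟩
    - det (suc (suc n)) Q ≈⟨ -‿cong (Σ-cong (suc (suc n)) (λ c → *-congˡ {x = sgn (toℕ c) * N zero c}
          (det-raise-row n j (minor N c)))) ⟩
    - Σ[< suc (suc n) ] (λ c → sgn (toℕ c) * N zero c * (sgn (toℕ j) * det (suc n) (minor N c)))
      ≈⟨ -‿cong (Σ-cong (suc (suc n)) (λ c → solve 4 (λ s x t d → s :* x :* (t :* d) := t :* (s :* x :* d)) refl (sgn (toℕ c)) (N zero c) (sgn (toℕ j)) (det (suc n) (minor N c)))) ⟩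
    - Σ[< suc (suc n) ] (λ c → sgn (toℕ j) * (sgn (toℕ c) * N zero c * det (suc n) (minor N c)))
      ≈⟨ -‿cong (sym (Σ-*ˡ (suc (suc n)) (sgn (toℕ j)) (λ c → sgn (toℕ c) * N zero c * det (suc n) (minor N c)))) ⟩
    - (sgn (toℕ j) * det (suc (suc n)) N) ≈⟨ solve 2 (λ t d → :- (t :* d) := (:- con (+ 1) :* t) :* d) refl _ _ ⟩
    sgn (toℕ (suc j)) * det (suc (suc n)) N ∎
    where
    Q : Mat (suc (suc n))
    Q zero = N zero
    Q (suc a) = raise j (λ a' → N (suc a')) a
    q0 : ∀ k → raise (suc j) N zero k ≈ Q (suc zero) k
    q0 k = refl
    q1 : ∀ k → raise (suc j) N (suc zero) k ≈ Q zero k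
    q1 k = refl
    qr : ∀ i → i ≢ zero → i ≢ suc zero → ∀ k → raise (suc j) N i k ≈ Q i k
    qr zero ne _ k = ⊥-elim (ne P.refl)
    qr (suc zero) _ ne k = ⊥-elim (ne P.refl)
    qr (suc (suc a)) _ _ k = refl

  -- Reversing the order of the n rows is a product of tri n = n(n-1)/2 adjacent
  -- transpositions (move the last row to the top, then reverse the rest).
  det-reverse-rows : ∀ n (N : Mat n) → det n (λ p j → N (opposite p) j) ≈ sgn (tri n) * det n N
  det-reverse-rows zero N = sym (*-identityˡ _)
  det-reverse-rows (suc n) N = begin
    Σ[< suc n ] (λ c → sgn (toℕ c) * N (F.fromℕ n) c * det n (λ a b → N (inject₁ (opposite a)) (punchIn c b)))
      ≈⟨ Σ-cong (suc n) (λ c → *-congˡ {x = sgn (toℕ c) * N (F.fromℕ n) c} (det-reverse-rows n (λ a b → N (inject₁ a) (punchIn c b)))) ⟩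
    Σ[< suc n ] (λ c → sgn (toℕ c) * N (F.fromℕ n) c * (sgn (tri n) * det n (λ a b → N (inject₁ a) (punchIn c b))))
      ≈⟨ Σ-cong (suc n) (λ c → solve 4 (λ s x t d → s :* x :* (t :* d) := t :* (s :* x :* d)) refl (sgn (toℕ c)) (N (F.fromℕ n) c) (sgn (tri n)) (det n (λ a b → N (inject₁ a) (punchIn c b)))) ⟩
    Σ[< suc n ] (λ c → sgn (tri n) * (sgn (toℕ c) * N (F.fromℕ n) c * det n (λ a b → N (inject₁ a) (punchIn c b))))
      ≈⟨ sym (Σ-*ˡ (suc n) (sgn (tri n)) (λ c → sgn (toℕ c) * N (F.fromℕ n) c * det n (λ a b → N (inject₁ a) (punchIn c b)))) ⟩
    sgn (tri n) * Σ[< suc n ] (λ c → sgn (toℕ c) * N (F.fromℕ n) c * det n (λ a b → N (inject₁ a) (punchIn c b)))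
      ≈⟨ *-congˡ (Σ-cong (suc n) (λ c → *-congˡ {x = sgn (toℕ c) * N (F.fromℕ n) c}
            (det-cong n (λ a b → reflexive (P.cong (λ r → N r (punchIn c b)) (P.sym (punchIn-fromℕ a))))))) ⟩
    sgn (tri n) * det (suc n) (raise (F.fromℕ n) N)
      ≈⟨ *-congˡ (det-raise-row n (F.fromℕ n) N) ⟩
    sgn (tri n) * (sgn (toℕ (F.fromℕ n)) * det (suc n) N)
      ≈⟨ *-congˡ (*-congʳ (reflexive (P.cong sgn (FP.toℕ-fromℕ n)))) ⟩
    sgn (tri n) * (sgn n * det (suc n) N)
      ≈⟨ solve 3 (λ a b d → a :* (b :* d) := (b :* a) :* d) refl _ _ _ ⟩
    sgn n * sgn (tri n) * det (suc n) N ≈⟨ *-congʳ (sym (sgn-+ n (tri n))) ⟩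
    sgn (tri (suc n)) * det (suc n) N ∎


  -- Cauchy–Binet.  ΣInc k m F sums F over the strictly increasing maps Fin k → Fin m
  -- (the k-element subsets of Fin m), by recursion on whether 0 is in the subset.

  ΣInc : (k m : ℕ) → ((Fin k → Fin m) → Carrier) → Carrier
  ΣInc zero m F = F (λ ())
  ΣInc (suc k) zero F = 0#
  ΣInc (suc k) (suc m) F = ΣInc k m (λ s → F (cons zero (suc ∘ s))) + ΣInc (suc k) m (λ s → F (suc ∘ s))

  Extensional : ∀ {k m} → ((Fin k → Fin m) → Carrier) → Set ℓ
  Extensional {k} {m} F = ∀ (s s' : Fin k → Fin m) → (∀ i → s i ≡ s' i) → F s ≈ F s'

  ΣInc-cong : ∀ k m {F G : (Fin k → Fin m) → Carrier} → (∀ s → F s ≈ G s) → ΣInc k m F ≈ ΣInc k m G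
  ΣInc-cong zero m e = e _
  ΣInc-cong (suc k) zero e = refl
  ΣInc-cong (suc k) (suc m) e = +-cong (ΣInc-cong k m (λ s → e _)) (ΣInc-cong (suc k) m (λ s → e _))

  ΣInc-zero : ∀ k m → ΣInc k m (λ _ → 0#) ≈ 0#
  ΣInc-zero zero m = refl
  ΣInc-zero (suc k) zero = refl
  ΣInc-zero (suc k) (suc m) = trans (+-cong (ΣInc-zero k m) (ΣInc-zero (suc k) m)) (+-identityˡ _)

  ΣInc-distrib-+ : ∀ k m (F G : (Fin k → Fin m) → Carrier) → ΣInc k m (λ s → F s + G s) ≈ ΣInc k m F + ΣInc k m G
  ΣInc-distrib-+ zero m F G = refl
  ΣInc-distrib-+ (suc k) zero F G = sym (+-identityˡ _)
  ΣInc-distrib-+ (suc k) (suc m) F G = trans (+-cong (ΣInc-distrib-+ k m _ _) (ΣInc-distrib-+ (suc k) m _ _))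
    (solve 4 (λ a b c d → (a :+ b) :+ (c :+ d) := (a :+ c) :+ (b :+ d)) refl _ _ _ _)

  ΣInc-*ˡ : ∀ k m a (F : (Fin k → Fin m) → Carrier) → a * ΣInc k m F ≈ ΣInc k m (λ s → a * F s)
  ΣInc-*ˡ zero m a F = refl
  ΣInc-*ˡ (suc k) zero a F = zeroʳ _
  ΣInc-*ˡ (suc k) (suc m) a F = trans (distribˡ _ _ _) (+-cong (ΣInc-*ˡ k m a _) (ΣInc-*ˡ (suc k) m a _))

  ΣInc-neg : ∀ k m (F : (Fin k → Fin m) → Carrier) → - ΣInc k m F ≈ ΣInc k m (λ s → - F s)
  ΣInc-neg k m F = trans (solve 1 (λ x → :- x := :- con (+ 1) :* x) refl _)
    (trans (ΣInc-*ˡ k m (- 1#) F) (ΣInc-cong k m (λ s → solve 1 (λ x → :- con (+ 1) :* x := :- x) refl _)))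

  Σ-ΣInc-comm : ∀ n k m (f : Fin n → (Fin k → Fin m) → Carrier) →
    Σ[< n ] (λ r → ΣInc k m (f r)) ≈ ΣInc k m (λ s → Σ[< n ] (λ r → f r s))
  Σ-ΣInc-comm zero k m f = sym (ΣInc-zero k m)
  Σ-ΣInc-comm (suc n) k m f = trans (+-congˡ (Σ-ΣInc-comm n k m (λ r → f (suc r)))) (sym (ΣInc-distrib-+ k m _ _))

  record Alternating {k m} (Φ : (Fin (suc k) → Fin m) → Carrier) : Set ℓ where
    field
      extensional : Extensional Φ
      equal-adjacent : ∀ (s : Fin (suc k) → Fin m) (p : Fin k) → s (inject₁ p) ≡ s (suc p) → Φ s ≈ 0#
      swap-adjacent : ∀ (s s' : Fin (suc k) → Fin m) (p : Fin k) →
        s' (inject₁ p) ≡ s (suc p) → s' (suc p) ≡ s (inject₁ p) →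
        (∀ i → i ≢ inject₁ p → i ≢ suc p → s' i ≡ s i) → Φ s' ≈ - Φ s
  open Alternating

  Alternating-shift : ∀ {k m} {Φ : (Fin (suc k) → Fin (suc m)) → Carrier} → Alternating Φ → Alternating (λ s → Φ (suc ∘ s))
  Alternating-shift alt = record
    { extensional = λ s s' e → extensional alt _ _ (λ i → P.cong suc (e i))
    ; equal-adjacent = λ s p e → equal-adjacent alt _ p (P.cong suc e)
    ; swap-adjacent = λ s s' p e₁ e₂ others → swap-adjacent alt _ _ p (P.cong suc e₁) (P.cong suc e₂)
        (λ i ne₁ ne₂ → P.cong suc (others i ne₁ ne₂)) }

  Alternating-after-zero : ∀ {k m} {Φ : (Fin (suc (suc k)) → Fin (suc m)) → Carrier} →
    Alternating Φ → Alternating (λ s → Φ (cons zero (suc ∘ s)))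
  Alternating-after-zero {k} {m} {Φ} alt = record
    { extensional = λ s s' e → extensional alt _ _ (λ { zero → P.refl ; (suc i) → P.cong suc (e i) })
    ; equal-adjacent = λ s p e → equal-adjacent alt _ (suc p) (P.cong suc e)
    ; swap-adjacent = λ s s' p e₁ e₂ others → swap-adjacent alt _ _ (suc p) (P.cong suc e₁) (P.cong suc e₂) (shifted s s' p others) }
    where
    shifted : ∀ (s s' : Fin (suc k) → Fin m) p → (∀ i → i ≢ inject₁ p → i ≢ suc p → s' i ≡ s i) →
      ∀ i → i ≢ inject₁ (suc p) → i ≢ suc (suc p) → cons zero (suc ∘ s') i ≡ cons zero (suc ∘ s) i
    shifted s s' p others zero _ _ = P.refl
    shifted s s' p others (suc i) ne₁ ne₂ = P.cong suc (others i (ne₁ ∘ P.cong suc) (ne₂ ∘ P.cong suc))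

  insertionSum : ∀ {k m} → (Fin m → Carrier) → ((Fin k → Fin m) → Carrier) → (Fin (suc k) → Fin m) → Carrier
  insertionSum {k} a G T = Σ[< suc k ] (λ p → sgn (toℕ p) * a (T p) * G (T ∘ punchIn p))

  -- The combinatorial heart of Cauchy–Binet: inserting a new index r in front of an
  -- increasing sequence S and sorting the result T, an alternating Φ picks up the
  -- sign (-1)^p of the position p at which r lands in T.
  Σ-insert : ∀ m k (a : Fin m → Carrier) (G : (Fin k → Fin m) → Carrier) (Φ : (Fin (suc k) → Fin m) → Carrier) →
    Extensional G → Alternating Φ →
    Σ[< m ] (λ r → a r * ΣInc k m (λ S → G S * Φ (cons r S))) ≈ ΣInc (suc k) m (λ T → Φ T * insertionSum a G T)
  Σ-insert zero k a G Φ G-ext alt = refl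
  Σ-insert (suc m) zero a G Φ G-ext alt = begin
    a zero * (G (λ ()) * Φ (cons zero (λ ()))) + Σ[< m ] (λ r → a (suc r) * (G (λ ()) * Φ (cons (suc r) (λ ()))))
      ≈⟨ +-cong (solve 3 (λ x g f → x :* (g :* f) := f :* (con (+ 1) :* x :* g :+ con (+ 0))) refl (a zero) (G (λ ())) (Φ (cons zero (λ ()))))
           (trans (Σ-cong m (λ r → *-congˡ (*-cong (G-ext _ _ (λ ())) (extensional alt _ _ (λ { zero → P.refl })))))
             (Σ-insert m zero (a ∘ suc) (λ s → G (suc ∘ s)) (λ s → Φ (suc ∘ s)) (λ s s' e → G-ext _ _ (λ ())) (Alternating-shift alt))) ⟩
    Φ (cons zero (λ ())) * (1# * a zero * G (λ ()) + 0#) + ΣInc 1 m (λ T → Φ (suc ∘ T) * insertionSum (a ∘ suc) (λ s → G (suc ∘ s)) T)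
      ≈⟨ +-congʳ (*-cong (extensional alt _ _ (λ { zero → P.refl })) (+-congʳ (*-congˡ (G-ext _ _ (λ ()))))) ⟩
    ΣInc 1 (suc m) (λ T → Φ T * insertionSum a G T) ∎
  Σ-insert (suc m) (suc k) a G Φ G-ext alt = begin
    Σ[< suc m ] (λ r → a r * ΣInc (suc k) (suc m) (λ S → G S * Φ (cons r S)))
      ≈⟨ +-cong first-zero (Σ-cong m first-later) ⟩
    a zero * L₀ + Σ[< m ] (λ r → - X r + Y r)
      ≈⟨ +-congˡ (trans (Σ-distrib-+ m (λ r → - X r) Y) (+-congʳ (sym (Σ-neg m X)))) ⟩
    a zero * L₀ + (- Σ[< m ] X + Σ[< m ] Y)
      ≈⟨ +-congˡ (+-cong (-‿cong (Σ-insert m k (a ∘ suc) G₀ Φ₀ G₀-ext (Alternating-after-zero alt)))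
                          (Σ-insert m (suc k) (a ∘ suc) G₁ Φ₁ G₁-ext (Alternating-shift alt))) ⟩
    a zero * L₀ + (- ΣInc (suc k) m (λ T → Φ₀ T * insertionSum (a ∘ suc) G₀ T)
                   + ΣInc (suc (suc k)) m (λ T → Φ₁ T * insertionSum (a ∘ suc) G₁ T))
      ≈⟨ +-assoc _ _ _ ⟨
    (a zero * L₀ - ΣInc (suc k) m (λ T → Φ₀ T * insertionSum (a ∘ suc) G₀ T))
      + ΣInc (suc (suc k)) m (λ T → Φ₁ T * insertionSum (a ∘ suc) G₁ T)
      ≈⟨ +-congʳ starting-with-zero ⟩
    ΣInc (suc (suc k)) (suc m) (λ T → Φ T * insertionSum a G T) ∎
    where
    -- Restrictions to sequences that avoid 0 (index 1) or start with 0 (index 0).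
    G₁ : (Fin (suc k) → Fin m) → Carrier
    G₁ s = G (suc ∘ s)
    G₀ : (Fin k → Fin m) → Carrier
    G₀ s = G (cons zero (suc ∘ s))
    Φ₁ : (Fin (suc (suc k)) → Fin m) → Carrier
    Φ₁ s = Φ (suc ∘ s)
    Φ₀ : (Fin (suc k) → Fin m) → Carrier
    Φ₀ s = Φ (cons zero (suc ∘ s))
    G₁-ext : Extensional G₁
    G₁-ext s s' e = G-ext _ _ (λ i → P.cong suc (e i))
    G₀-ext : Extensional G₀
    G₀-ext s s' e = G-ext _ _ (λ { zero → P.refl ; (suc i) → P.cong suc (e i) })
    L₀ = ΣInc (suc k) m (λ s → G₁ s * Φ₀ s)
    X Y : Fin m → Carrier
    X r = a (suc r) * ΣInc k m (λ s → G₀ s * Φ₀ (cons r s))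
    Y r = a (suc r) * ΣInc (suc k) m (λ s → G₁ s * Φ₁ (cons r s))

    -- Inserting 0 in front of a sequence starting with 0 repeats an entry.
    first-zero : a zero * (ΣInc k m (λ s → G₀ s * Φ (cons zero (cons zero (suc ∘ s)))) + L₀) ≈ a zero * L₀
    first-zero = *-congˡ (trans (+-congʳ (trans
      (ΣInc-cong k m (λ s → trans (*-congˡ (equal-adjacent alt _ zero P.refl)) (zeroʳ _))) (ΣInc-zero k m)))
      (+-identityˡ L₀))

    -- Inserting r+1 in front of a sequence starting with 0 is one adjacent swap away
    -- from the sorted order; in front of a sequence avoiding 0 it is already sorted.
    swapped : ∀ r s → Φ (cons (suc r) (cons zero (suc ∘ s))) ≈ - Φ₀ (cons r s)
    swapped r s = trans
      (swap-adjacent alt (cons zero (cons (suc r) (suc ∘ s))) (cons (suc r) (cons zero (suc ∘ s))) zero P.refl P.refl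
        (λ { zero ne _ → ⊥-elim (ne P.refl) ; (suc zero) _ ne → ⊥-elim (ne P.refl) ; (suc (suc i)) _ _ → P.refl }))
      (-‿cong (extensional alt _ _ (λ { zero → P.refl ; (suc zero) → P.refl ; (suc (suc i)) → P.refl })))

    first-later : ∀ r → a (suc r) * ΣInc (suc k) (suc m) (λ S → G S * Φ (cons (suc r) S)) ≈ - X r + Y r
    first-later r = begin
      a (suc r) * (ΣInc k m (λ s → G₀ s * Φ (cons (suc r) (cons zero (suc ∘ s))))
                   + ΣInc (suc k) m (λ s → G₁ s * Φ (cons (suc r) (suc ∘ s))))
        ≈⟨ *-congˡ (+-cong (ΣInc-cong k m (λ s → *-congˡ (swapped r s)))
                           (ΣInc-cong (suc k) m (λ s → *-congˡ (extensional alt _ _ (λ { zero → P.refl ; (suc i) → P.refl }))))) ⟩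
      a (suc r) * (ΣInc k m (λ s → G₀ s * - Φ₀ (cons r s)) + ΣInc (suc k) m (λ s → G₁ s * Φ₁ (cons r s)))
        ≈⟨ *-congˡ (+-congʳ (trans (ΣInc-cong k m (λ s → sym (-‿distribʳ-* (G₀ s) (Φ₀ (cons r s))))) (sym (ΣInc-neg k m _)))) ⟩
      a (suc r) * (- ΣInc k m (λ s → G₀ s * Φ₀ (cons r s)) + ΣInc (suc k) m (λ s → G₁ s * Φ₁ (cons r s)))
        ≈⟨ solve 3 (λ x u v → x :* (:- u :+ v) := :- (x :* u) :+ x :* v) refl (a (suc r)) _ _ ⟩
      - X r + Y r ∎

    -- For T starting with 0 the term p = 0 of insertionSum a G T is a₀ G(T without 0),
    -- and the remaining terms are those of the shorter sequence with signs flipped.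
    leading-term : ∀ s → a zero * (G₁ s * Φ₀ s) - Φ₀ s * insertionSum (a ∘ suc) G₀ s
                         ≈ Φ₀ s * insertionSum a G (cons zero (suc ∘ s))
    leading-term s = begin
      a zero * (G₁ s * Φ₀ s) - Φ₀ s * insertionSum (a ∘ suc) G₀ s
        ≈⟨ +-congˡ (-‿cong (*-congˡ (trans (Σ-cong (suc k) flip-sign) (sym (Σ-neg (suc k) tail))))) ⟩
      a zero * (G₁ s * Φ₀ s) - Φ₀ s * - Σ[< suc k ] tail
        ≈⟨ solve 4 (λ x g f t → x :* (g :* f) :- f :* (:- t) := f :* (con (+ 1) :* x :* g :+ t)) refl (a zero) (G₁ s) (Φ₀ s) _ ⟩
      Φ₀ s * insertionSum a G (cons zero (suc ∘ s)) ∎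
      where
      tail : Fin (suc k) → Carrier
      tail p = sgn (toℕ (suc p)) * a (suc (s p)) * G (cons zero (suc ∘ s) ∘ punchIn (suc p))
      flip-sign : ∀ p → sgn (toℕ p) * a (suc (s p)) * G₀ (s ∘ punchIn p) ≈ - tail p
      flip-sign p = begin
        sgn (toℕ p) * a (suc (s p)) * G₀ (s ∘ punchIn p)
          ≈⟨ solve 3 (λ t x g → t :* x :* g := :- ((:- con (+ 1) :* t) :* x :* g)) refl (sgn (toℕ p)) _ _ ⟩
        - ((- 1# * sgn (toℕ p)) * a (suc (s p)) * G₀ (s ∘ punchIn p))
          ≈⟨ -‿cong (*-congˡ (G-ext _ _ (λ { zero → P.refl ; (suc b) → P.refl }))) ⟩
        - tail p ∎

    starting-with-zero : a zero * L₀ - ΣInc (suc k) m (λ T → Φ₀ T * insertionSum (a ∘ suc) G₀ T)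
      ≈ ΣInc (suc k) m (λ s → Φ₀ s * insertionSum a G (cons zero (suc ∘ s)))
    starting-with-zero = trans (+-cong (ΣInc-*ˡ (suc k) m _ _) (ΣInc-neg (suc k) m _))
      (trans (sym (ΣInc-distrib-+ (suc k) m _ _)) (ΣInc-cong (suc k) m leading-term))

  selectRows : ∀ {m k n} → (Fin m → Fin n → Carrier) → (Fin k → Fin m) → Fin k → Fin n → Carrier
  selectRows K T p b = K (T p) b

  selectCols : ∀ {m k n} → (Fin n → Fin m → Carrier) → (Fin k → Fin m) → Fin n → Fin k → Carrier
  selectCols A T i p = A i (T p)

  det-rows-alternating : ∀ k m (K : Fin m → Fin (suc k) → Carrier) → Alternating (λ T → det (suc k) (selectRows K T))
  det-rows-alternating zero m K = record
    { extensional = λ s s' e → det-cong 1 (λ p b → reflexive (P.cong (λ r → K r b) (e p)))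
    ; equal-adjacent = λ s ()
    ; swap-adjacent = λ s s' () }
  det-rows-alternating (suc k) m K = record
    { extensional = λ s s' e → det-cong (suc (suc k)) (λ p b → reflexive (P.cong (λ r → K r b) (e p)))
    ; equal-adjacent = λ s p e → det-equal-adjacent-rows k (selectRows K s) p (λ b → reflexive (P.cong (λ r → K r b) e))
    ; swap-adjacent = λ s s' p e₁ e₂ others → det-swap-adjacent k p (selectRows K s) (selectRows K s')
        ((λ b → reflexive (P.cong (λ r → K r b) e₁)) , (λ b → reflexive (P.cong (λ r → K r b) e₂)) ,
         (λ i ne₁ ne₂ b → reflexive (P.cong (λ r → K r b) (others i ne₁ ne₂)))) }

  -- Proof: expand along the first row,
  -- apply the formula to the minors, and regroup the terms with Σ-insert.
  cauchy-binet : ∀ n m (A : Fin n → Fin m → Carrier) (K : Fin m → Fin n → Carrier) →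
    det n (λ i j → Σ[< m ] (λ r → A i r * K r j)) ≈ ΣInc n m (λ T → det n (selectCols A T) * det n (selectRows K T))
  cauchy-binet zero m A K = sym (*-identityˡ _)
  cauchy-binet (suc k) m A K = begin
    Σ[< suc k ] (λ j → sgn (toℕ j) * Σ[< m ] (λ r → A zero r * K r j) * det k (λ a b → Σ[< m ] (λ r → A (suc a) r * K r (punchIn j b))))
      ≈⟨ Σ-cong (suc k) (λ j → *-congˡ {x = sgn (toℕ j) * Σ[< m ] (λ r → A zero r * K r j)}
            (cauchy-binet k m (λ a r → A (suc a) r) (λ r b → K r (punchIn j b)))) ⟩
    Σ[< suc k ] (λ j → sgn (toℕ j) * Σ[< m ] (λ r → A zero r * K r j) * ΣInc k m (λ S → G S * H j S))
      ≈⟨ Σ-cong (suc k) distribute ⟩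
    Σ[< suc k ] (λ j → Σ[< m ] (λ r → A zero r * ΣInc k m (λ S → G S * (sgn (toℕ j) * K r j * H j S))))
      ≈⟨ Σ-comm (suc k) m (λ j r → A zero r * ΣInc k m (λ S → G S * (sgn (toℕ j) * K r j * H j S))) ⟩
    Σ[< m ] (λ r → Σ[< suc k ] (λ j → A zero r * ΣInc k m (λ S → G S * (sgn (toℕ j) * K r j * H j S))))
      ≈⟨ Σ-cong m collect ⟩
    Σ[< m ] (λ r → A zero r * ΣInc k m (λ S → G S * Φ (cons r S)))
      ≈⟨ Σ-insert m k (A zero) G Φ (λ s s' e → det-cong k (λ i q → reflexive (P.cong (A (suc i)) (e q)))) (det-rows-alternating k m K) ⟩
    ΣInc (suc k) m (λ T → Φ T * insertionSum (A zero) G T)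
      ≈⟨ ΣInc-cong (suc k) m (λ T → *-comm _ _) ⟩
    ΣInc (suc k) m (λ T → det (suc k) (selectCols A T) * det (suc k) (selectRows K T)) ∎
    where
    G : (Fin k → Fin m) → Carrier
    G S = det k (λ i p → A (suc i) (S p))
    H : Fin (suc k) → (Fin k → Fin m) → Carrier
    H j S = det k (λ p b → K (S p) (punchIn j b))
    Φ : (Fin (suc k) → Fin m) → Carrier
    Φ T = det (suc k) (selectRows K T)
    distribute : ∀ j → sgn (toℕ j) * Σ[< m ] (λ r → A zero r * K r j) * ΣInc k m (λ S → G S * H j S)
                ≈ Σ[< m ] (λ r → A zero r * ΣInc k m (λ S → G S * (sgn (toℕ j) * K r j * H j S)))
    distribute j = begin
      sgn (toℕ j) * Σ[< m ] (λ r → A zero r * K r j) * ΣInc k m (λ S → G S * H j S)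
        ≈⟨ *-congʳ (Σ-*ˡ m (sgn (toℕ j)) (λ r → A zero r * K r j)) ⟩
      Σ[< m ] (λ r → sgn (toℕ j) * (A zero r * K r j)) * ΣInc k m (λ S → G S * H j S)
        ≈⟨ Σ-*ʳ m _ (λ r → sgn (toℕ j) * (A zero r * K r j)) ⟩
      Σ[< m ] (λ r → sgn (toℕ j) * (A zero r * K r j) * ΣInc k m (λ S → G S * H j S))
        ≈⟨ Σ-cong m (λ r → trans (ΣInc-*ˡ k m (sgn (toℕ j) * (A zero r * K r j)) (λ S → G S * H j S))
               (trans (ΣInc-cong k m (λ S → solve 5 (λ s x y g h → s :* (x :* y) :* (g :* h) := x :* (g :* (s :* y :* h))) refl
                    (sgn (toℕ j)) (A zero r) (K r j) (G S) (H j S)))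
               (sym (ΣInc-*ˡ k m (A zero r) (λ S → G S * (sgn (toℕ j) * K r j * H j S)))))) ⟩
      Σ[< m ] (λ r → A zero r * ΣInc k m (λ S → G S * (sgn (toℕ j) * K r j * H j S))) ∎
    -- Summing over j reassembles the first-row expansion of det (selectRows K (cons r S)).
    collect : ∀ r → Σ[< suc k ] (λ j → A zero r * ΣInc k m (λ S → G S * (sgn (toℕ j) * K r j * H j S)))
                ≈ A zero r * ΣInc k m (λ S → G S * Φ (cons r S))
    collect r = begin
      Σ[< suc k ] (λ j → A zero r * ΣInc k m (λ S → G S * (sgn (toℕ j) * K r j * H j S)))
        ≈⟨ Σ-*ˡ (suc k) (A zero r) (λ j → ΣInc k m (λ S → G S * (sgn (toℕ j) * K r j * H j S))) ⟨
      A zero r * Σ[< suc k ] (λ j → ΣInc k m (λ S → G S * (sgn (toℕ j) * K r j * H j S)))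
        ≈⟨ *-congˡ (Σ-ΣInc-comm (suc k) k m (λ j S → G S * (sgn (toℕ j) * K r j * H j S))) ⟩
      A zero r * ΣInc k m (λ S → Σ[< suc k ] (λ j → G S * (sgn (toℕ j) * K r j * H j S)))
        ≈⟨ *-congˡ (ΣInc-cong k m (λ S → sym (Σ-*ˡ (suc k) (G S) (λ j → sgn (toℕ j) * K r j * H j S)))) ⟩
      A zero r * ΣInc k m (λ S → G S * Φ (cons r S)) ∎

  ΣInc-too-long : ∀ k m (F : (Fin (suc k) → Fin m) → Carrier) → m ≤ k → ΣInc (suc k) m F ≈ 0#
  ΣInc-too-long k zero F le = refl
  ΣInc-too-long (suc k) (suc m) F (s≤s le) =
    trans (+-cong (ΣInc-too-long k m _ le) (ΣInc-too-long (suc k) m _ (ℕP.m≤n⇒m≤1+n le))) (+-identityˡ _)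

  ΣInc-square : ∀ n (F : (Fin n → Fin n) → Carrier) → Extensional F → ΣInc n n F ≈ F (λ i → i)
  ΣInc-square zero F F-ext = F-ext _ _ (λ ())
  ΣInc-square (suc n) F F-ext = trans
    (+-cong (ΣInc-square n (λ s → F (cons zero (suc ∘ s))) (λ s s' e → F-ext _ _ (λ { zero → P.refl ; (suc i) → P.cong suc (e i) })))
            (ΣInc-too-long n n _ ℕP.≤-refl))
    (trans (+-identityʳ _) (F-ext _ _ (λ { zero → P.refl ; (suc i) → P.refl })))

  ΣInc-omit-one : ∀ n (F : (Fin n → Fin (suc n)) → Carrier) → Extensional F →
    ΣInc n (suc n) F ≈ Σ[< suc n ] (λ k → F (punchIn k))
  ΣInc-omit-one zero F F-ext = sym (trans (+-identityʳ _) (F-ext _ _ (λ ())))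
  ΣInc-omit-one (suc n) F F-ext = trans
    (+-cong (ΣInc-omit-one n (λ s → F (cons zero (suc ∘ s))) (λ s s' e → F-ext _ _ (λ { zero → P.refl ; (suc i) → P.cong suc (e i) })))
            (ΣInc-square (suc n) (λ s → F (suc ∘ s)) (λ s s' e → F-ext _ _ (λ i → P.cong suc (e i)))))
    (trans (+-comm _ _) (+-cong (F-ext _ _ (λ i → P.refl))
       (Σ-cong (suc n) (λ k → F-ext (cons zero (suc ∘ punchIn k)) (punchIn (suc k)) (λ { zero → P.refl ; (suc b) → P.refl })))))

  selected-dets-extensional : ∀ n m (A : Fin n → Fin m → Carrier) (K : Fin m → Fin n → Carrier) →
    Extensional (λ T → det n (selectCols A T) * det n (selectRows K T))
  selected-dets-extensional n m A K s s' e = *-cong (det-cong n (λ i p → reflexive (P.cong (A i) (e p))))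
                                                    (det-cong n (λ p j → reflexive (P.cong (λ r → K r j) (e p))))

  -- det(A·K) = det A · det K: Cauchy–Binet with a single subset.
  det-multiplicative : ∀ n (A K : Mat n) → det n (λ i j → Σ[< n ] (λ r → A i r * K r j)) ≈ det n A * det n K
  det-multiplicative n A K = trans (cauchy-binet n n A K) (ΣInc-square n _ (selected-dets-extensional n n A K))

  Π-lt-step : ∀ n (f : Fin (suc n) → Fin (suc n) → Carrier) →
    Π-lt (suc n) f ≈ Π[< n ] (λ j → f zero (suc j)) * Π-lt n (λ i j → f (suc i) (suc j))
  Π-lt-step n f = trans (*-cong (Π-one (suc n) (λ i → refl)) (Π-distrib-* n _ _)) (*-identityˡ _)

  Π-lt-distrib-* : ∀ n (f g : Fin n → Fin n → Carrier) → Π-lt n (λ i j → f i j * g i j) ≈ Π-lt n f * Π-lt n g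
  Π-lt-distrib-* n f g = trans (Π-cong n (λ j → trans (Π-cong n (λ i → guarded (toℕ i ℕ.<ᵇ toℕ j) i j)) (Π-distrib-* n _ _)))
                               (Π-distrib-* n _ _)
    where
    guarded : ∀ b i j → (if b then f i j * g i j else 1#) ≈ (if b then f i j else 1#) * (if b then g i j else 1#)
    guarded true i j = refl
    guarded false i j = sym (*-identityˡ _)

  vandermondeProduct : ∀ n → (Fin n → Carrier) → Carrier
  vandermondeProduct n x = Π-lt n (λ i j → x j - x i)

  vandermonde : ∀ n → (Fin n → Carrier) → Carrier
  vandermonde n x = det n (λ i p → pow (x i) (toℕ p))

  -- Multiplying on the right by the unipotent bidiagonal matrix
  -- with -μ_{p+1} in position (p, p+1) replaces column p+1 by itself minus μ_{p+1}
  -- times column p, and does not change the determinant.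
  elimination : ∀ {n} → (Fin n → Carrier) → Mat n
  elimination μ zero zero = 1#
  elimination μ zero (suc zero) = - μ (suc zero)
  elimination μ zero (suc (suc p)) = 0#
  elimination μ (suc q) zero = 0#
  elimination μ (suc q) (suc p) = elimination (μ ∘ suc) q p

  det-elimination : ∀ n (μ : Fin n → Carrier) → det n (elimination μ) ≈ 1#
  det-elimination zero μ = refl
  det-elimination (suc zero) μ = solve 0 (con (+ 1) :* con (+ 1) :* con (+ 1) :+ con (+ 0) := con (+ 1)) refl
  det-elimination (suc (suc n)) μ = begin
    1# * 1# * det (suc n) (elimination (μ ∘ suc))
      + (sgn 1 * - μ (suc zero) * det (suc n) (minor (elimination μ) (suc zero))
         + Σ[< n ] (λ p → sgn (toℕ (suc (suc p))) * 0# * det (suc n) (minor (elimination μ) (suc (suc p)))))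
      ≈⟨ +-cong (*-congˡ (det-elimination (suc n) (μ ∘ suc)))
                (+-cong (trans (*-congˡ (det-zero-first-column n (minor (elimination μ) (suc zero)) (λ a → refl))) (zeroʳ _))
                        (Σ-zero n (λ p → trans (*-congʳ (zeroʳ _)) (zeroˡ _)))) ⟩
    1# * 1# * 1# + (0# + 0#)
      ≈⟨ solve 0 (con (+ 1) :* con (+ 1) :* con (+ 1) :+ (con (+ 0) :+ con (+ 0)) := con (+ 1)) refl ⟩
    1# ∎

  eliminate : ∀ {n} → (Fin (suc n) → Carrier) → (Fin (suc n) → Carrier) → Fin (suc n) → Carrier
  eliminate X μ zero = X zero
  eliminate X μ (suc p) = X (suc p) - μ (suc p) * X (inject₁ p)

  row-times-elimination : ∀ n (X μ : Fin (suc n) → Carrier) (p : Fin (suc n)) →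
    Σ[< suc n ] (λ q → X q * elimination μ q p) ≈ eliminate X μ p
  row-times-elimination zero X μ zero = trans (+-identityʳ _) (*-identityʳ _)
  row-times-elimination (suc n) X μ zero = trans (+-cong (*-identityʳ _) (Σ-zero (suc n) (λ q → zeroʳ (X (suc q))))) (+-identityʳ _)
  row-times-elimination (suc n) X μ (suc zero) = begin
    X zero * - μ (suc zero) + (X (suc zero) * 1# + Σ[< n ] (λ q → X (suc (suc q)) * 0#))
      ≈⟨ +-congˡ (+-cong (*-identityʳ _) (Σ-zero n (λ q → zeroʳ _))) ⟩
    X zero * - μ (suc zero) + (X (suc zero) + 0#)
      ≈⟨ solve 3 (λ x m y → x :* (:- m) :+ (y :+ con (+ 0)) := y :- m :* x) refl (X zero) (μ (suc zero)) (X (suc zero)) ⟩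
    X (suc zero) - μ (suc zero) * X zero ∎
  row-times-elimination (suc (suc n)) X μ (suc (suc p)) =
    trans (+-cong (zeroʳ _) (row-times-elimination (suc n) (X ∘ suc) (μ ∘ suc) (suc p))) (+-identityˡ _)

  det-eliminate-columns : ∀ n (X : Mat (suc n)) (μ : Fin (suc n) → Carrier) →
    det (suc n) X ≈ det (suc n) (λ i p → eliminate (X i) μ p)
  det-eliminate-columns n X μ = begin
    det (suc n) X                                          ≈⟨ *-identityʳ _ ⟨
    det (suc n) X * 1#                                     ≈⟨ *-congˡ (det-elimination (suc n) μ) ⟨
    det (suc n) X * det (suc n) (elimination μ)            ≈⟨ det-multiplicative (suc n) X (elimination μ) ⟨
    det (suc n) (λ i j → Σ[< suc n ] (λ r → X i r * elimination μ r j))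
      ≈⟨ det-cong (suc n) (λ i p → row-times-elimination n (X i) μ p) ⟩
    det (suc n) (λ i p → eliminate (X i) μ p)              ∎

  pow-inject₁ : ∀ y {n} (p : Fin n) → pow y (toℕ (inject₁ p)) ≈ pow y (toℕ p)
  pow-inject₁ y p = reflexive (P.cong (pow y) (FP.toℕ-inject₁ p))

  -- Subtracting x₀ times each column from the next one clears the first row and
  -- leaves (x_{a+1} - x₀) x_{a+1}^b in the lower block.
  vandermonde-step : ∀ n (x : Fin (suc n) → Carrier) →
    vandermonde (suc n) x ≈ Π[< n ] (λ a → x (suc a) - x zero) * vandermonde n (x ∘ suc)
  vandermonde-step n x = begin
    vandermonde (suc n) x ≈⟨ det-eliminate-columns n (λ i p → pow (x i) (toℕ p)) (λ _ → x zero) ⟩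
    det (suc n) (λ i p → eliminate (λ q → pow (x i) (toℕ q)) (λ _ → x zero) p)
      ≈⟨ det-unit-first-row n (λ i p → eliminate (λ q → pow (x i) (toℕ q)) (λ _ → x zero) p) refl (λ p → trans (+-congˡ (-‿cong (*-congˡ (pow-inject₁ (x zero) p)))) (-‿inverseʳ _)) ⟩
    det n (λ a b → x (suc a) * pow (x (suc a)) (toℕ b) - x zero * pow (x (suc a)) (toℕ (inject₁ b)))
      ≈⟨ det-cong n (λ a b → trans (+-congˡ (-‿cong (*-congˡ (pow-inject₁ (x (suc a)) b))))
            (solve 3 (λ y z q → y :* q :- z :* q := (y :- z) :* q) refl (x (suc a)) (x zero) (pow (x (suc a)) (toℕ b)))) ⟩
    det n (λ a b → (x (suc a) - x zero) * pow (x (suc a)) (toℕ b)) ≈⟨ det-scale-rows n _ _ ⟩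
    Π[< n ] (λ a → x (suc a) - x zero) * vandermonde n (x ∘ suc) ∎

  vandermonde-formula : ∀ n (x : Fin n → Carrier) → vandermonde n x ≈ vandermondeProduct n x
  vandermonde-formula zero x = refl
  vandermonde-formula (suc n) x = begin
    vandermonde (suc n) x                                                ≈⟨ vandermonde-step n x ⟩
    Π[< n ] (λ a → x (suc a) - x zero) * vandermonde n (x ∘ suc)         ≈⟨ *-congˡ (vandermonde-formula n (x ∘ suc)) ⟩
    Π[< n ] (λ a → x (suc a) - x zero) * vandermondeProduct n (x ∘ suc)  ≈⟨ Π-lt-step n (λ i j → x j - x i) ⟨
    vandermondeProduct (suc n) x                                         ∎

  σ-too-many : ∀ k n (x : Fin n → Carrier) → n ≤ k → σ (suc k) n x ≈ 0#
  σ-too-many k zero x le = refl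
  σ-too-many (suc k) (suc n) x (s≤s le) =
    trans (+-cong (trans (*-congˡ (σ-too-many k n _ le)) (zeroʳ _)) (σ-too-many (suc k) n _ (ℕP.m≤n⇒m≤1+n le))) (+-identityˡ _)

  σ-top : ∀ n (x : Fin n → Carrier) → σ n n x ≈ Π[< n ] x
  σ-top zero x = refl
  σ-top (suc n) x = trans (+-cong (*-congˡ (σ-top n (x ∘ suc))) (σ-too-many n n _ ℕP.≤-refl)) (+-identityʳ _)

  -- The Vandermonde determinant with the exponent k omitted: det [x_i^e], where e runs
  -- through {0, …, n} ∖ {k} in increasing order.
  skipVandermonde : ∀ n → Fin (suc n) → (Fin n → Carrier) → Carrier
  skipVandermonde n k x = det n (λ i p → pow (x i) (toℕ (punchIn k p)))

  -- The induction step for an omitted exponent h+1 with h < n, in the n+1 variables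
  -- x₀ and y = (x₁, …, xₙ).  Subtract from each column μ times the previous one, where
  -- μ = x₀ except μ = x₀² just after the gap; this clears the first row and leaves
  -- (yₐ - x₀) Wₐ in the remaining block, whose row h is the only one not of
  -- skipped-Vandermonde shape and splits into two such rows by linearity.
  module SkipStep (n : ℕ) (h : Fin n) (x : Fin (suc n) → Carrier) where
    x₀ : Carrier
    x₀ = x zero
    y : Fin n → Carrier
    y a = x (suc a)

    e : Fin (suc n) → ℕ
    e q = toℕ (punchIn (suc (inject₁ h)) q)

    atGap : Fin n → Bool
    atGap b = toℕ b ℕ.≡ᵇ toℕ h

    μ : Fin (suc n) → Carrier
    μ zero = 0#
    μ (suc b) = if atGap b then x₀ * x₀ else x₀

    W : Carrier → Fin n → Carrier
    W z b = pow z (toℕ (punchIn (inject₁ h) b)) + (if atGap b then x₀ * pow z (toℕ b) else 0#)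

    toℕ-h : toℕ (inject₁ h) ≡ toℕ h
    toℕ-h = FP.toℕ-inject₁ h

    entry-below : ∀ z (b : Fin n) → toℕ b ℕ.< toℕ h →
      pow z (e (suc b)) - x₀ * pow z (e (inject₁ b)) ≈ (z - x₀) * (pow z (toℕ (punchIn (inject₁ h) b)) + 0#)
    entry-below z b lt = begin
      z * pow z (toℕ (punchIn (inject₁ h) b)) - x₀ * pow z (e (inject₁ b))
        ≈⟨ +-cong (*-congˡ (reflexive (P.cong (pow z) same))) (-‿cong (*-congˡ (reflexive (P.cong (pow z) previous)))) ⟩
      z * pow z (toℕ b) - x₀ * pow z (toℕ b)
        ≈⟨ solve 3 (λ z x q → z :* q :- x :* q := (z :- x) :* (q :+ con (+ 0))) refl z x₀ (pow z (toℕ b)) ⟩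
      (z - x₀) * (pow z (toℕ b) + 0#)
        ≈⟨ *-congˡ (+-congʳ (reflexive (P.cong (pow z) (P.sym same)))) ⟩
      (z - x₀) * (pow z (toℕ (punchIn (inject₁ h) b)) + 0#) ∎
      where
      same : toℕ (punchIn (inject₁ h) b) ≡ toℕ b
      same = toℕ-punchIn-< (inject₁ h) b (P.subst (toℕ b ℕ.<_) (P.sym toℕ-h) lt)
      previous : e (inject₁ b) ≡ toℕ b
      previous = P.trans (toℕ-punchIn-< (suc (inject₁ h)) (inject₁ b)
        (s≤s (P.subst₂ _≤_ (P.sym (FP.toℕ-inject₁ b)) (P.sym toℕ-h) (ℕP.<⇒≤ lt)))) (FP.toℕ-inject₁ b)

    entry-at : ∀ z (b : Fin n) → toℕ b ≡ toℕ h →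
      pow z (e (suc b)) - x₀ * x₀ * pow z (e (inject₁ b)) ≈ (z - x₀) * (pow z (toℕ (punchIn (inject₁ h) b)) + x₀ * pow z (toℕ b))
    entry-at z b eq = begin
      z * pow z (toℕ (punchIn (inject₁ h) b)) - x₀ * x₀ * pow z (e (inject₁ b))
        ≈⟨ +-cong (*-congˡ (reflexive (P.cong (pow z) next))) (-‿cong (*-congˡ (reflexive (P.cong (pow z) previous)))) ⟩
      z * (z * pow z (toℕ b)) - x₀ * x₀ * pow z (toℕ b)
        ≈⟨ solve 3 (λ z x q → z :* (z :* q) :- x :* x :* q := (z :- x) :* (z :* q :+ x :* q)) refl z x₀ (pow z (toℕ b)) ⟩
      (z - x₀) * (z * pow z (toℕ b) + x₀ * pow z (toℕ b))
        ≈⟨ *-congˡ (+-congʳ (reflexive (P.cong (pow z) (P.sym next)))) ⟩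
      (z - x₀) * (pow z (toℕ (punchIn (inject₁ h) b)) + x₀ * pow z (toℕ b)) ∎
      where
      next : toℕ (punchIn (inject₁ h) b) ≡ suc (toℕ b)
      next = toℕ-punchIn-≥ (inject₁ h) b (ℕP.≤-reflexive (P.trans toℕ-h (P.sym eq)))
      previous : e (inject₁ b) ≡ toℕ b
      previous = P.trans (toℕ-punchIn-< (suc (inject₁ h)) (inject₁ b)
        (s≤s (ℕP.≤-reflexive (P.trans (FP.toℕ-inject₁ b) (P.trans eq (P.sym toℕ-h)))))) (FP.toℕ-inject₁ b)

    entry-above : ∀ z (b : Fin n) → toℕ h ℕ.< toℕ b →
      pow z (e (suc b)) - x₀ * pow z (e (inject₁ b)) ≈ (z - x₀) * (pow z (toℕ (punchIn (inject₁ h) b)) + 0#)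
    entry-above z b gt = begin
      z * pow z (toℕ (punchIn (inject₁ h) b)) - x₀ * pow z (e (inject₁ b))
        ≈⟨ +-cong (*-congˡ (reflexive (P.cong (pow z) next))) (-‿cong (*-congˡ (reflexive (P.cong (pow z) previous)))) ⟩
      z * (z * pow z (toℕ b)) - x₀ * (z * pow z (toℕ b))
        ≈⟨ solve 3 (λ z x q → z :* (z :* q) :- x :* (z :* q) := (z :- x) :* (z :* q :+ con (+ 0))) refl z x₀ (pow z (toℕ b)) ⟩
      (z - x₀) * (z * pow z (toℕ b) + 0#)
        ≈⟨ *-congˡ (+-congʳ (reflexive (P.cong (pow z) (P.sym next)))) ⟩
      (z - x₀) * (pow z (toℕ (punchIn (inject₁ h) b)) + 0#) ∎
      where
      next : toℕ (punchIn (inject₁ h) b) ≡ suc (toℕ b)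
      next = toℕ-punchIn-≥ (inject₁ h) b (P.subst (_≤ toℕ b) (P.sym toℕ-h) (ℕP.<⇒≤ gt))
      previous : e (inject₁ b) ≡ suc (toℕ b)
      previous = P.trans (toℕ-punchIn-≥ (suc (inject₁ h)) (inject₁ b)
        (P.subst₂ _≤_ (P.cong suc (P.sym toℕ-h)) (P.sym (FP.toℕ-inject₁ b)) gt)) (P.cong suc (FP.toℕ-inject₁ b))

    entry : ∀ z (b : Fin n) → pow z (e (suc b)) - μ (suc b) * pow z (e (inject₁ b)) ≈ (z - x₀) * W z b
    entry z b with ℕP.<-cmp (toℕ b) (toℕ h) | atGap b in gap
    ... | tri< lt _ _ | false = entry-below z b lt
    ... | tri≈ _ eq _ | true = entry-at z b eq
    ... | tri> _ _ gt | false = entry-above z b gt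
    ... | tri< _ ne _ | true = ⊥-elim (ne (ℕP.≡ᵇ⇒≡ (toℕ b) (toℕ h) (P.subst T (P.sym gap) tt)))
    ... | tri> _ ne _ | true = ⊥-elim (ne (ℕP.≡ᵇ⇒≡ (toℕ b) (toℕ h) (P.subst T (P.sym gap) tt)))
    ... | tri≈ _ eq _ | false = ⊥-elim (P.subst T gap (ℕP.≡⇒≡ᵇ (toℕ b) (toℕ h) eq))

    W-at-gap : ∀ a → W (y a) h ≈ 1# * pow (y a) (toℕ (punchIn (inject₁ h) h)) + x₀ * pow (y a) (toℕ (punchIn (suc h) h))
    W-at-gap a = +-cong (sym (*-identityˡ _)) (trans (reflexive (P.cong (if_then x₀ * pow (y a) (toℕ h) else 0#) gap-refl))
      (*-congˡ (reflexive (P.cong (pow (y a)) (P.sym (toℕ-punchIn-< (suc h) h ℕP.≤-refl))))))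
      where
      gap-refl : atGap h ≡ true
      gap-refl = Equivalence.to T-≡ (ℕP.≡⇒≡ᵇ (toℕ h) (toℕ h) P.refl)

    W-off-gap : ∀ b → b ≢ h → ∀ a → (W (y a) b ≈ pow (y a) (toℕ (punchIn (inject₁ h) b))) ×
                                     (W (y a) b ≈ pow (y a) (toℕ (punchIn (suc h) b)))
    W-off-gap b b≢h a = plain , trans plain (reflexive (P.cong (pow (y a)) same-exponent))
      where
      b≢h' : toℕ b ≢ toℕ h
      b≢h' = b≢h ∘ FP.toℕ-injective
      plain : W (y a) b ≈ pow (y a) (toℕ (punchIn (inject₁ h) b))
      plain = trans (+-congˡ (reflexive (P.cong (if_then x₀ * pow (y a) (toℕ b) else 0#) gap-false))) (+-identityʳ _)
        where
        gap-false : atGap b ≡ false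
        gap-false = ¬-not (λ gap → b≢h' (ℕP.≡ᵇ⇒≡ (toℕ b) (toℕ h) (P.subst T (P.sym gap) tt)))
      same-exponent : toℕ (punchIn (inject₁ h) b) ≡ toℕ (punchIn (suc h) b)
      same-exponent with ℕP.<-cmp (toℕ b) (toℕ h)
      ... | tri< lt _ _ = P.trans (toℕ-punchIn-< (inject₁ h) b (P.subst (toℕ b ℕ.<_) (P.sym toℕ-h) lt))
                                  (P.sym (toℕ-punchIn-< (suc h) b (ℕP.m≤n⇒m≤1+n lt)))
      ... | tri≈ _ eq _ = ⊥-elim (b≢h' eq)
      ... | tri> _ _ gt = P.trans (toℕ-punchIn-≥ (inject₁ h) b (P.subst (_≤ toℕ b) (P.sym toℕ-h) (ℕP.<⇒≤ gt)))
                                  (P.sym (toℕ-punchIn-≥ (suc h) b gt))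

    Π₀ : Carrier
    Π₀ = Π[< n ] (λ a → y a - x₀)

    skipVandermonde-step : skipVandermonde (suc n) (suc (inject₁ h)) x
      ≈ Π₀ * (1# * skipVandermonde n (inject₁ h) y + x₀ * skipVandermonde n (suc h) y)
    skipVandermonde-step = begin
      skipVandermonde (suc n) (suc (inject₁ h)) x ≈⟨ det-eliminate-columns n (λ i p → pow (x i) (e p)) μ ⟩
      det (suc n) (λ i p → eliminate (λ q → pow (x i) (e q)) μ p)
        ≈⟨ det-unit-first-row n (λ i p → eliminate (λ q → pow (x i) (e q)) μ p) refl
             (λ b → trans (entry x₀ b) (trans (*-congʳ (-‿inverseʳ x₀)) (zeroˡ _))) ⟩
      det n (λ a b → pow (y a) (e (suc b)) - μ (suc b) * pow (y a) (e (inject₁ b)))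
        ≈⟨ det-cong n (λ a b → entry (y a) b) ⟩
      det n (λ a b → (y a - x₀) * W (y a) b)                 ≈⟨ det-scale-rows n (λ a → y a - x₀) (λ a b → W (y a) b) ⟩
      Π₀ * det n (λ a b → W (y a) b)                         ≈⟨ *-congˡ (det-transpose n (λ a b → W (y a) b)) ⟨
      Π₀ * det n (λ b a → W (y a) b)
        ≈⟨ *-congˡ (det-linear-row n h 1# x₀ (λ b a → W (y a) b) (λ b a → pow (y a) (toℕ (punchIn (inject₁ h) b)))
                 (λ b a → pow (y a) (toℕ (punchIn (suc h) b))) W-at-gap W-off-gap) ⟩
      Π₀ * (1# * det n (λ b a → pow (y a) (toℕ (punchIn (inject₁ h) b))) + x₀ * det n (λ b a → pow (y a) (toℕ (punchIn (suc h) b))))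
        ≈⟨ *-congˡ (+-cong (*-congˡ (det-transpose n (λ a b → pow (y a) (toℕ (punchIn (inject₁ h) b)))))
                           (*-congˡ (det-transpose n (λ a b → pow (y a) (toℕ (punchIn (suc h) b)))))) ⟩
      Π₀ * (1# * skipVandermonde n (inject₁ h) y + x₀ * skipVandermonde n (suc h) y) ∎

  -- Induction on n: omitting 0 factors out x₁⋯xₙ,
  -- omitting n gives the plain Vandermonde determinant, and any other gap is handled
  -- by SkipStep together with σ_{j+1}(x₀, y) = x₀ σ_j(y) + σ_{j+1}(y).
  skipVandermonde-formula : ∀ n (k : Fin (suc n)) (x : Fin n → Carrier) →
    skipVandermonde n k x ≈ σ (n ∸ toℕ k) n x * vandermondeProduct n x
  skipVandermonde-formula zero zero x = sym (*-identityˡ _)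
  skipVandermonde-formula (suc n) zero x = trans (det-scale-rows (suc n) x (λ i p → pow (x i) (toℕ p)))
    (*-cong (sym (σ-top (suc n) x)) (vandermonde-formula (suc n) x))
  skipVandermonde-formula (suc n) (suc k) x with last-or-inject₁ k
  ... | inj₁ P.refl = begin
    skipVandermonde (suc n) (suc (F.fromℕ n)) x
      ≈⟨ det-cong (suc n) (λ i p → reflexive (P.cong (pow (x i)) (P.trans (P.cong toℕ (punchIn-fromℕ p)) (FP.toℕ-inject₁ p)))) ⟩
    vandermonde (suc n) x                         ≈⟨ vandermonde-formula (suc n) x ⟩
    vandermondeProduct (suc n) x                  ≈⟨ *-identityˡ _ ⟨
    σ 0 (suc n) x * vandermondeProduct (suc n) x  ≡⟨ P.cong (λ t → σ t (suc n) x * vandermondeProduct (suc n) x) no-gap ⟨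
    σ (n ∸ toℕ (F.fromℕ n)) (suc n) x * vandermondeProduct (suc n) x ∎
    where
    no-gap : n ∸ toℕ (F.fromℕ n) ≡ 0
    no-gap = P.trans (P.cong (n ∸_) (FP.toℕ-fromℕ n)) (ℕP.n∸n≡0 n)
  ... | inj₂ (h , P.refl) = begin
    skipVandermonde (suc n) (suc (inject₁ h)) x
      ≈⟨ skipVandermonde-step ⟩
    Π₀ * (1# * skipVandermonde n (inject₁ h) y + x₀ * skipVandermonde n (suc h) y)
      ≈⟨ *-congˡ (+-cong (*-congˡ (skipVandermonde-formula n (inject₁ h) y)) (*-congˡ (skipVandermonde-formula n (suc h) y))) ⟩
    Π₀ * (1# * (σ (n ∸ toℕ (inject₁ h)) n y * vandermondeProduct n y) + x₀ * (σ j n y * vandermondeProduct n y))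
      ≡⟨ P.cong (λ t → Π₀ * (1# * (σ t n y * vandermondeProduct n y) + x₀ * (σ j n y * vandermondeProduct n y))) degree ⟩
    Π₀ * (1# * (σ (suc j) n y * vandermondeProduct n y) + x₀ * (σ j n y * vandermondeProduct n y))
      ≈⟨ solve 5 (λ p a b x₀ v → p :* (con (+ 1) :* (a :* v) :+ x₀ :* (b :* v)) := (x₀ :* b :+ a) :* (p :* v)) refl
           Π₀ (σ (suc j) n y) (σ j n y) x₀ (vandermondeProduct n y) ⟩
    σ (suc j) (suc n) x * (Π₀ * vandermondeProduct n y)
      ≈⟨ *-congˡ (Π-lt-step n (λ i j → x j - x i)) ⟨
    σ (suc j) (suc n) x * vandermondeProduct (suc n) x
      ≡⟨ P.cong (λ t → σ t (suc n) x * vandermondeProduct (suc n) x) degree ⟨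
    σ (n ∸ toℕ (inject₁ h)) (suc n) x * vandermondeProduct (suc n) x ∎
    where
    open SkipStep n h x
    j : ℕ
    j = n ∸ suc (toℕ h)
    degree : n ∸ toℕ (inject₁ h) ≡ suc j
    degree = P.trans (P.cong (n ∸_) (FP.toℕ-inject₁ h)) (ℕP.+-∸-assoc 1 (FP.toℕ<n h))

  module Binomial = Algebra.Properties.CommutativeSemiring.Binomial commutativeSemiring
  module Exp = Algebra.Properties.Semiring.Exp semiring
  module Mult = Algebra.Properties.Semiring.Mult semiring
  module Sum = Algebra.Properties.Semiring.Sum semiring

  pow≈^ : ∀ a m → a Exp.^ m ≈ pow a m
  pow≈^ a zero = refl
  pow≈^ a (suc m) = *-congˡ (pow≈^ a m)

  ×≈fromℕ* : ∀ m a → m Mult.× a ≈ fromℕ m * a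
  ×≈fromℕ* zero a = sym (zeroˡ a)
  ×≈fromℕ* (suc m) a = trans (+-cong (sym (*-identityˡ a)) (×≈fromℕ* m a)) (sym (distribʳ a 1# (fromℕ m)))

  sum≈Σ : ∀ m (f : Fin m → Carrier) → Sum.sum f ≈ Σ[< m ] f
  sum≈Σ zero f = refl
  sum≈Σ (suc m) f = +-congˡ (sum≈Σ m (f ∘ suc))

  pow-cong : ∀ {a b} m → a ≈ b → pow a m ≈ pow b m
  pow-cong zero e = refl
  pow-cong (suc m) e = *-cong e (pow-cong m e)

  binomial : ∀ n a b → pow (a + b) n ≈ Σ[< suc n ] (λ r → pow a (n ∸ toℕ r) * (fromℕ (n C toℕ r) * pow b (toℕ r)))
  binomial n a b = begin
    pow (a + b) n                          ≈⟨ pow-cong n (+-comm a b) ⟩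
    pow (b + a) n                          ≈⟨ pow≈^ (b + a) n ⟨
    (b + a) Exp.^ n                        ≈⟨ Binomial.theorem n b a ⟩
    Binomial.binomialExpansion b a n       ≈⟨ sum≈Σ (suc n) (Binomial.binomialTerm b a n) ⟩
    Σ[< suc n ] (Binomial.binomialTerm b a n)
      ≈⟨ Σ-cong (suc n) (λ r → trans (×≈fromℕ* (n C toℕ r) _)
           (trans (*-congˡ (*-cong (pow≈^ b (toℕ r)) (pow≈^ a (n ∸ toℕ r))))
             (solve 3 (λ c p q → c :* (p :* q) := q :* (c :* p)) refl (fromℕ (n C toℕ r)) (pow b (toℕ r)) (pow a (n ∸ toℕ r))))) ⟩
    Σ[< suc n ] (λ r → pow a (n ∸ toℕ r) * (fromℕ (n C toℕ r) * pow b (toℕ r))) ∎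

  Π-except : ∀ m (k : Fin (suc m)) (g : Fin (suc m) → Carrier) →
    Π[< suc m ] (λ r → if does (r F.≟ k) then 1# else g r) ≈ Π[< m ] (λ p → g (punchIn k p))
  Π-except m zero g = *-identityˡ _
  Π-except (suc m) (suc k) g = *-congˡ (Π-except m k (g ∘ suc))

  y-side : ∀ n (k : Fin (suc n)) (y : Fin n → Carrier) →
    det n (λ p j → fromℕ (n C toℕ (punchIn k p)) * pow (y j) (toℕ (punchIn k p)))
      ≈ binomProdExcept n k * (σ (n ∸ toℕ k) n y * vandermondeProduct n y)
  y-side n k y = begin
    det n (λ p j → fromℕ (n C toℕ (punchIn k p)) * pow (y j) (toℕ (punchIn k p)))
      ≈⟨ det-scale-rows n (λ p → fromℕ (n C toℕ (punchIn k p))) (λ p j → pow (y j) (toℕ (punchIn k p))) ⟩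
    Π[< n ] (λ p → fromℕ (n C toℕ (punchIn k p))) * det n (λ p j → pow (y j) (toℕ (punchIn k p)))
      ≈⟨ *-cong (sym (Π-except n k (λ r → fromℕ (n C toℕ r)))) (det-transpose n (λ j p → pow (y j) (toℕ (punchIn k p)))) ⟩
    binomProdExcept n k * skipVandermonde n k y     ≈⟨ *-congˡ (skipVandermonde-formula n k y) ⟩
    binomProdExcept n k * (σ (n ∸ toℕ k) n y * vandermondeProduct n y) ∎

  -- The x-side minor: det [x_i^{n-e}], e ∈ {0..n} ∖ {k}.  Reversing the rows of its
  -- transpose gives the skipped Vandermonde determinant with gap n-k.
  x-side : ∀ n (k : Fin (suc n)) (x : Fin n → Carrier) →
    det n (λ i p → pow (x i) (n ∸ toℕ (punchIn k p))) ≈ sgn (tri n) * (σ (toℕ k) n x * vandermondeProduct n x)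
  x-side n k x = begin
    det n (λ i p → N p i)                            ≈⟨ det-transpose n N ⟩
    det n N                                          ≈⟨ sign-twice ⟨
    sgn (tri n) * (sgn (tri n) * det n N)            ≈⟨ *-congˡ (det-reverse-rows n N) ⟨
    sgn (tri n) * det n (λ p j → N (opposite p) j)
      ≈⟨ *-congˡ (det-cong n (λ p j → reflexive (P.cong (pow (x j)) (punchIn-opposite n k p)))) ⟩
    sgn (tri n) * det n (λ p j → pow (x j) (toℕ (punchIn (opposite k) p)))
      ≈⟨ *-congˡ (det-transpose n (λ j p → pow (x j) (toℕ (punchIn (opposite k) p)))) ⟩
    sgn (tri n) * skipVandermonde n (opposite k) x   ≈⟨ *-congˡ (skipVandermonde-formula n (opposite k) x) ⟩
    sgn (tri n) * (σ (n ∸ toℕ (opposite k)) n x * vandermondeProduct n x)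
      ≡⟨ P.cong (λ t → sgn (tri n) * (σ t n x * vandermondeProduct n x)) complement ⟩
    sgn (tri n) * (σ (toℕ k) n x * vandermondeProduct n x) ∎
    where
    N : Mat n
    N p j = pow (x j) (n ∸ toℕ (punchIn k p))
    sign-twice : sgn (tri n) * (sgn (tri n) * det n N) ≈ det n N
    sign-twice = trans (sym (*-assoc _ _ _)) (trans (*-congʳ (sgn-square (tri n))) (*-identityˡ _))
    complement : n ∸ toℕ (opposite k) ≡ toℕ k
    complement = P.trans (P.cong (n ∸_) (FP.opposite-prop k)) (ℕP.m∸[m∸n]≡n (ℕP.≤-pred (FP.toℕ<n k)))

  det-power-of-sum : ∀ n (x y : Fin n → Carrier) →
    det n (λ i j → pow (x i + y j) n)
      ≈ pow (- 1#) ((n ℕ.* (n ∸ 1)) / 2) * Π-lt n (λ i j → (x j - x i) * (y j - y i))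
        * Σ[< suc n ] (λ k → binomProdExcept n k * σ (toℕ k) n x * σ (n ∸ toℕ k) n y)
  det-power-of-sum n x y = begin
    det n (λ i j → pow (x i + y j) n)                  ≈⟨ det-cong n (λ i j → binomial n (x i) (y j)) ⟩
    det n (λ i j → Σ[< suc n ] (λ r → A i r * K r j))  ≈⟨ cauchy-binet n (suc n) A K ⟩
    ΣInc n (suc n) (λ T → det n (selectCols A T) * det n (selectRows K T))
      ≈⟨ ΣInc-omit-one n _ (selected-dets-extensional n (suc n) A K) ⟩
    Σ[< suc n ] (λ k → det n (selectCols A (punchIn k)) * det n (selectRows K (punchIn k)))
      ≈⟨ Σ-cong (suc n) (λ k → *-cong (x-side n k x) (y-side n k y)) ⟩
    Σ[< suc n ] (λ k → sgn (tri n) * (σ (toℕ k) n x * Vx) * (binomProdExcept n k * (σ (n ∸ toℕ k) n y * Vy)))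
      ≈⟨ Σ-cong (suc n) (λ k → solve 6 (λ s a v b w p → s :* (a :* v) :* (p :* (b :* w)) := s :* (v :* w) :* (p :* a :* b)) refl
              (sgn (tri n)) (σ (toℕ k) n x) Vx (σ (n ∸ toℕ k) n y) Vy (binomProdExcept n k)) ⟩
    Σ[< suc n ] (λ k → sgn (tri n) * (Vx * Vy) * term k)
      ≈⟨ Σ-*ˡ (suc n) (sgn (tri n) * (Vx * Vy)) term ⟨
    sgn (tri n) * (Vx * Vy) * Σ[< suc n ] term
      ≈⟨ *-congʳ (*-cong (reflexive (P.cong (pow (- 1#)) (tri-eq n))) (sym (Π-lt-distrib-* n (λ i j → x j - x i) (λ i j → y j - y i)))) ⟩
    pow (- 1#) ((n ℕ.* (n ∸ 1)) / 2) * Π-lt n (λ i j → (x j - x i) * (y j - y i)) * Σ[< suc n ] term ∎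
    where
    A : Fin n → Fin (suc n) → Carrier
    A i r = pow (x i) (n ∸ toℕ r)
    K : Fin (suc n) → Fin n → Carrier
    K r j = fromℕ (n C toℕ r) * pow (y j) (toℕ r)
    Vx Vy : Carrier
    Vx = vandermondeProduct n x
    Vy = vandermondeProduct n y
    term : Fin (suc n) → Carrier
    term k = binomProdExcept n k * σ (toℕ k) n x * σ (n ∸ toℕ k) n y

-- Theorem 3.1.
theorem3p1 : {c ℓ : Level} (R : CommutativeRing c ℓ) →
    let open CommutativeRing R
        open RingDefs R
    in (n : ℕ) → 1 ≤ n → (x y : Fin n → Carrier) →
       det n (λ i j → pow (x i + y j) n)
         ≈ pow (- 1#) ((n Data.Nat.* (n ∸ 1)) / 2)
           * Π-lt n (λ i j → (x j - x i) * (y j - y i))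
           * Σ[< Data.Nat.suc n ] (λ k → binomProdExcept n k
                 * σ (toℕ k) n x * σ (n ∸ toℕ k) n y)
theorem3p1 R n _ x y = det-power-of-sum R n x y
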